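{- Let $W(x,y)$ be a formal weight enumerator of degree $n$ of the form $W(x,y)=x^n+\sum_{i=d}^n A_i x^{n-i}y^i$ with $A_d\neq 0$, $d\ge1$, and let $P(T)$ be its zeta polynomial. Put $g=\frac{n}{2}+1-d$. Then $P(T)$ has degree $2g$ and satisfies $$P(T)=-P\Bigl(\frac{1}{2T}\Bigr)2^g T^{2g}.$$
   Context: A formal weight enumerator is a homogeneous polynomial $W(x,y)=\sum_{i=0}^n A_i x^{n-i}y^i\in\mathbf{C}[x,y]$ such that (i) $A_i\neq 0$ implies $4\mid i$, and (ii) $W\left(\frac{x+y}{\sqrt 2},\frac{x-y}{\sqrt 2}\right)=-W(x,y)$. For $W(x,y)=x^n+\sum_{i=d}^n A_i x^{n-i}y^i$ ($A_d\ne0$), its zeta polynomial (with $q=2$) is the unique polynomial $P(T)\in\mathbf{C}[T]$ of degree at most $n-d$ such that, in the power series expansion in $T$ of $$\frac{P(T)}{(1-T)(1-2T)}\,(y(1-T)+xT)^n,$$ the coefficient of $T^{n-d}$ equals $\frac{W(x,y)-x^n}{2-1}=W(x,y)-x^n$. -}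

module Defs where

open import Level using (_⊔_)
open import Data.Nat as ℕ using (ℕ; zero; suc; _∸_; _≡ᵇ_; _<_)
open import Data.Nat.Divisibility using (_∣_)
open import Data.Bool using (if_then_else_; _∧_)
open import Data.Product using (Σ; _×_)
open import Relation.Nullary using (¬_)
open import Algebra.Bundles using (CommutativeRing)

-- An element of R[x,y][[T]] is represented by its coefficient function
--   F m a b  =  coefficient of  T^m x^a y^b .
-- Elements of R[x,y] are those with only T^0 terms; elements of R[T]
-- (or R[[T]]) those with only x^0 y^0 terms.
module Poly {c ℓ} (R : CommutativeRing c ℓ) where
  open CommutativeRing R

  Σ≤ : ℕ → (ℕ → Carrier) → Carrier
  Σ≤ zero    f = f 0
  Σ≤ (suc n) f = Σ≤ n f + f (suc n)

  fromℕ : ℕ → Carrier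
  fromℕ zero    = 0#
  fromℕ (suc k) = 1# + fromℕ k

  two : Carrier
  two = 1# + 1#

  pw : Carrier → ℕ → Carrier
  pw u zero    = 1#
  pw u (suc k) = u * pw u k

  Ser : Set c
  Ser = ℕ → ℕ → ℕ → Carrier

  _≐_ : Ser → Ser → Set ℓ
  F ≐ G = ∀ m a b → F m a b ≈ G m a b

  _⊕_ : Ser → Ser → Ser
  (F ⊕ G) m a b = F m a b + G m a b

  ⊝_ : Ser → Ser
  (⊝ F) m a b = - F m a b

  _·_ : Carrier → Ser → Ser
  (u · F) m a b = u * F m a b

  _⊛_ : Ser → Ser → Ser
  (F ⊛ G) m a b =
    Σ≤ m λ m₁ → Σ≤ a λ a₁ → Σ≤ b λ b₁ →
      F m₁ a₁ b₁ * G (m ∸ m₁) (a ∸ a₁) (b ∸ b₁)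

  mono : Carrier → ℕ → ℕ → ℕ → Ser
  mono u m a b m' a' b' =
    if (m ≡ᵇ m') ∧ (a ≡ᵇ a') ∧ (b ≡ᵇ b') then u else 0#

  𝟙 𝕋 𝕏 𝕐 : Ser
  𝟙 = mono 1# 0 0 0
  𝕋 = mono 1# 1 0 0
  𝕏 = mono 1# 0 1 0
  𝕐 = mono 1# 0 0 1

  _^^_ : Ser → ℕ → Ser
  F ^^ zero  = 𝟙
  F ^^ suc k = F ⊛ (F ^^ k)

  Σs : ℕ → (ℕ → Ser) → Ser
  Σs zero    F = F 0
  Σs (suc n) F = Σs n F ⊕ F (suc n)

  -- the power series 1/(1 - u T) = Σ_m u^m T^m
  geom : Carrier → Ser
  geom u m a b = if (a ≡ᵇ 0) ∧ (b ≡ᵇ 0) then pw u m else 0#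

  -- the polynomial P(T) = Σ_j p j T^j (only meaningful for finitely supported p)
  univ : (ℕ → Carrier) → Ser
  univ p m a b = if (a ≡ᵇ 0) ∧ (b ≡ᵇ 0) then p m else 0#

  hom : ℕ → (ℕ → Carrier) → Ser
  hom n A = Σs n λ i → A i · ((𝕏 ^^ (n ∸ i)) ⊛ (𝕐 ^^ i))

  -- W((x+y)/√2, (x-y)/√2), where r plays the role of 1/√2
  subst√2 : Carrier → ℕ → (ℕ → Carrier) → Ser
  subst√2 r n A =
    Σs n λ i → A i · (((r · (𝕏 ⊕ 𝕐)) ^^ (n ∸ i)) ⊛ ((r · (𝕏 ⊕ (⊝ 𝕐))) ^^ i))

  IsFieldChar0 : Set (c ⊔ ℓ)
  IsFieldChar0 =
    (¬ 1# ≈ 0#)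
    × (∀ u → ¬ u ≈ 0# → Σ Carrier λ v → u * v ≈ 1#)
    × (∀ k → ¬ fromℕ (suc k) ≈ 0#)

  -- formal weight enumerator of degree n with coefficients A_0..A_n
  -- (the values A i for i > n are ignored)
  IsFormalWE : Carrier → ℕ → (ℕ → Carrier) → Set ℓ
  IsFormalWE r n A =
    (∀ i → i ℕ.≤ n → ¬ A i ≈ 0# → 4 ∣ i)
    × (subst√2 r n A ≐ (⊝ hom n A))

  -- P (coefficients p) is the zeta polynomial (q = 2) of
  -- W = x^n + Σ_{i=d}^{n} A_i x^{n-i} y^i
  IsZetaPoly : ℕ → ℕ → (ℕ → Carrier) → (ℕ → Carrier) → Set ℓ
  IsZetaPoly n d A p =
    (∀ j → n ∸ d < j → p j ≈ 0#)
    × (∀ a b →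
        ((univ p ⊛ geom 1#) ⊛ (geom two ⊛ (((𝕐 ⊕ (⊝ (𝕋 ⊛ 𝕐))) ⊕ (𝕋 ⊛ 𝕏)) ^^ n)))
          (n ∸ d) a b
        ≈ (hom n A ⊕ (⊝ (𝕏 ^^ n))) 0 a b)

  HasDegree : (ℕ → Carrier) → ℕ → Set ℓ
  HasDegree p k = (¬ p k ≈ 0#) × (∀ j → k < j → p j ≈ 0#)

  -- P(T) = - P(1/(2T)) 2^g T^{2g}, for P of degree 2g, compared
  -- coefficientwise: the coefficient of T^k on the right is
  -- -p_{2g-k} 2^{k-g}; multiplied through by 2^g.
  FuncEq : (ℕ → Carrier) → ℕ → Set ℓ
  FuncEq p g = ∀ k → k ℕ.≤ 2 ℕ.* g →
    pw two g * p k ≈ - (pw two k * p (2 ℕ.* g ∸ k))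

{-# OPTIONS --safe #-}
module Submission where

-- Everything is compared after the substitution S : x ↦ x + y, which turns y(1 - T) + xT
-- into y + xT and the MacWilliams transform into W(r(x + 2y), rx).  Put u 0 = u 1 = 1 and
-- u(m + 2) = 1 + [Tᵐ] P(T)/((1 - T)(1 - 2T)).  Then the zeta equation says that the
-- coefficient B j of xʲyⁿ⁻ʲ in W(x + y, y) is C(n, j) u(n - d + 2 - j), and W ↦ -W says
-- rⁿ 2ᵏ B k = -B j for j + k = n; together, rⁿ 2ᵏ u(n - d + 2 - k) = -u(n - d + 2 - j).
-- The degree is even: A i = 0 for odd i forces A n = A 0 = 1, so 4 ∣ n.  With n = 2h we get
-- rⁿ = 2⁻ʰ, and j = d - 1 shows d ≤ h.  Re-indexed, u is reflected about g + 1 = h + 2 - d,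
-- and P, the second difference (1 - T)(1 - 2T) of the generating series of u, inherits the
-- reflection P(T) = -P(1/(2T)) 2ᵍ T²ᵍ.  Its constant term A d / C(n, d), hence also its
-- leading coefficient, is nonzero.

open import Defs
open import Level using (Level; _⊔_)
open import Algebra.Bundles using (CommutativeRing)
open import Data.Bool using (true; false)
open import Data.Bool.Properties using (T-≡; ¬-not)
open import Data.Empty using (⊥-elim)
open import Data.Nat as ℕ using (ℕ; zero; suc; _∸_; _≤_; _<_; z≤n; s≤s; _≡ᵇ_)
import Data.Nat.Properties as ℕₚ
open import Data.Nat.Combinatorics using (_C_; nCn≡1; k>n⇒nCk≡0; nCk≡nC[n∸k]; nCk+nC[k+1]≡[n+1]C[k+1])
open import Data.Nat.Divisibility using (_∣_; divides)
open import Data.Nat.Tactic.RingSolver using (solve-∀)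
open import Data.Product using (Σ; _×_; _,_; proj₁; proj₂)
open import Data.Sum using (_⊎_; inj₁; inj₂)
open import Function using (_∘_; case_of_; Equivalence)
open import Relation.Binary.Definitions using (tri<; tri≈; tri>)
open import Relation.Binary.PropositionalEquality using (_≡_; _≢_)
import Relation.Binary.PropositionalEquality as ≡
import Relation.Binary.Reasoning.Setoid as SetoidReasoning
open import Relation.Nullary using (¬_; yes; no)

≡ᵇ-refl : ∀ n → (n ≡ᵇ n) ≡ true
≡ᵇ-refl n = Equivalence.to T-≡ (ℕₚ.≡⇒≡ᵇ n n ≡.refl)

≢⇒≡ᵇ-false : ∀ m n → m ≢ n → (m ≡ᵇ n) ≡ false
≢⇒≡ᵇ-false m n m≢n = ¬-not (m≢n ∘ ℕₚ.≡ᵇ⇒≡ m n ∘ Equivalence.from T-≡)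

k≤n⇒nCk>0 : ∀ {n k} → k ≤ n → 0 < n C k
k≤n⇒nCk>0 {k = zero} _ = s≤s z≤n
k≤n⇒nCk>0 {suc n} {suc k} (s≤s k≤n) =
  ≡.subst (0 <_) (nCk+nC[k+1]≡[n+1]C[k+1] n k) (ℕₚ.<-≤-trans (k≤n⇒nCk>0 k≤n) (ℕₚ.m≤m+n _ _))

[a+b]Ca≡[a+b]Cb : ∀ a b → (a ℕ.+ b) C a ≡ (a ℕ.+ b) C b
[a+b]Ca≡[a+b]Cb a b = ≡.trans (nCk≡nC[n∸k] (ℕₚ.m≤m+n a b)) (≡.cong ((a ℕ.+ b) C_) (ℕₚ.m+n∸m≡n a b))

k<i⇒[j+k]∸i<j : ∀ j k i → k < i → i ≤ j ℕ.+ k → (j ℕ.+ k) ∸ i < j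
k<i⇒[j+k]∸i<j j k i k<i i≤j+k = ℕₚ.+-cancelʳ-< i ((j ℕ.+ k) ∸ i) j
  (≡.subst (_< j ℕ.+ i) (≡.sym (ℕₚ.m∸n+n≡m i≤j+k)) (ℕₚ.+-monoʳ-< j k<i))

parity : ∀ n → Σ ℕ (λ h → n ≡ 2 ℕ.* h) ⊎ Σ ℕ (λ h → n ≡ suc (2 ℕ.* h))
parity zero = inj₁ (0 , ≡.refl)
parity (suc n) with parity n
... | inj₁ (h , n≡2h)   = inj₂ (h , ≡.cong suc n≡2h)
... | inj₂ (h , n≡2h+1) = inj₁ (suc h , ≡.trans (≡.cong suc n≡2h+1) (≡.sym (ℕₚ.*-suc 2 h)))

4∤odd : ∀ h → ¬ 4 ∣ suc (2 ℕ.* h)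
4∤odd h (divides q 2h+1≡q*4) = ℕₚ.even≢odd (q ℕ.* 2) h (≡.sym (≡.trans 2h+1≡q*4 (q*4≡2*[q*2] q)))
  where
  q*4≡2*[q*2] : ∀ q → q ℕ.* 4 ≡ 2 ℕ.* (q ℕ.* 2)
  q*4≡2*[q*2] = solve-∀

¬¬-∀≤ : ∀ {a} (P : ℕ → Set a) N → (∀ i → i ≤ N → ¬ ¬ P i) → ¬ ¬ (∀ i → i ≤ N → P i)
¬¬-∀≤ P zero    ¬¬P ¬∀P = ¬¬P 0 z≤n λ P0 → ¬∀P λ { zero _ → P0 ; (suc i) () }
¬¬-∀≤ P (suc N) ¬¬P ¬∀P =
  ¬¬-∀≤ P N (λ i i≤N → ¬¬P i (ℕₚ.m≤n⇒m≤1+n i≤N)) λ ∀P → ¬¬P (suc N) ℕₚ.≤-refl λ P[1+N] →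
    ¬∀P λ i i≤1+N → case i ℕₚ.≟ suc N of λ
      { (yes ≡.refl) → P[1+N]
      ; (no i≢1+N)   → ∀P i (ℕₚ.≤-pred (ℕₚ.≤∧≢⇒< i≤1+N i≢1+N)) }

module FiniteSums {c ℓ} (R : CommutativeRing c ℓ) where
  open CommutativeRing R hiding (zero)
  open Poly R using (Σ≤)
  open import Algebra.Properties.Ring ring using (-‿+-comm)
  open import Algebra.Properties.CommutativeSemigroup +-commutativeSemigroup using (interchange)
  open SetoidReasoning setoid

  Σ≤-cong : ∀ n {f g : ℕ → Carrier} → (∀ i → i ≤ n → f i ≈ g i) → Σ≤ n f ≈ Σ≤ n g
  Σ≤-cong zero    f≈g = f≈g 0 z≤n
  Σ≤-cong (suc n) f≈g = +-cong (Σ≤-cong n λ i i≤n → f≈g i (ℕₚ.m≤n⇒m≤1+n i≤n)) (f≈g (suc n) ℕₚ.≤-refl)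

  Σ≤-cong′ : ∀ n {f g : ℕ → Carrier} → (∀ i → f i ≈ g i) → Σ≤ n f ≈ Σ≤ n g
  Σ≤-cong′ n f≈g = Σ≤-cong n λ i _ → f≈g i

  Σ≤-distrib-+ : ∀ n (f g : ℕ → Carrier) → Σ≤ n (λ i → f i + g i) ≈ Σ≤ n f + Σ≤ n g
  Σ≤-distrib-+ zero    f g = refl
  Σ≤-distrib-+ (suc n) f g = trans (+-congʳ (Σ≤-distrib-+ n f g)) (interchange _ _ _ _)

  *-distribˡ-Σ≤ : ∀ n u (f : ℕ → Carrier) → u * Σ≤ n f ≈ Σ≤ n (λ i → u * f i)
  *-distribˡ-Σ≤ zero    u f = refl
  *-distribˡ-Σ≤ (suc n) u f = trans (distribˡ u _ _) (+-congʳ (*-distribˡ-Σ≤ n u f))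

  -‿distrib-Σ≤ : ∀ n (f : ℕ → Carrier) → - Σ≤ n f ≈ Σ≤ n (λ i → - f i)
  -‿distrib-Σ≤ zero    f = refl
  -‿distrib-Σ≤ (suc n) f = trans (sym (-‿+-comm _ _)) (+-congʳ (-‿distrib-Σ≤ n f))

  Σ≤-zero : ∀ n {f : ℕ → Carrier} → (∀ i → i ≤ n → f i ≈ 0#) → Σ≤ n f ≈ 0#
  Σ≤-zero zero    f≈0 = f≈0 0 z≤n
  Σ≤-zero (suc n) f≈0 =
    trans (+-cong (Σ≤-zero n λ i i≤n → f≈0 i (ℕₚ.m≤n⇒m≤1+n i≤n)) (f≈0 (suc n) ℕₚ.≤-refl)) (+-identityˡ 0#)

  Σ≤-single : ∀ n k {f : ℕ → Carrier} → k ≤ n → (∀ i → i ≤ n → i ≢ k → f i ≈ 0#) → Σ≤ n f ≈ f k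
  Σ≤-single zero    .zero z≤n _   = refl
  Σ≤-single (suc n) k     k≤n f≈0 with k ℕₚ.≟ suc n
  ... | yes ≡.refl = trans (+-congʳ (Σ≤-zero n λ i i≤n → f≈0 i (ℕₚ.m≤n⇒m≤1+n i≤n) (ℕₚ.<⇒≢ (s≤s i≤n))))
                           (+-identityˡ _)
  ... | no k≢1+n   = trans (+-cong (Σ≤-single n k (ℕₚ.≤-pred (ℕₚ.≤∧≢⇒< k≤n k≢1+n))
                                      λ i i≤n → f≈0 i (ℕₚ.m≤n⇒m≤1+n i≤n))
                                   (f≈0 (suc n) ℕₚ.≤-refl (k≢1+n ∘ ≡.sym)))
                           (+-identityʳ _)

  Σ≤-suc-head : ∀ n (f : ℕ → Carrier) → Σ≤ (suc n) f ≈ f 0 + Σ≤ n (λ i → f (suc i))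
  Σ≤-suc-head zero    f = refl
  Σ≤-suc-head (suc n) f = trans (+-congʳ (Σ≤-suc-head n f)) (+-assoc _ _ _)

  Σ≤-reverse : ∀ n (f : ℕ → Carrier) → Σ≤ n f ≈ Σ≤ n (λ i → f (n ∸ i))
  Σ≤-reverse zero    f = refl
  Σ≤-reverse (suc n) f = begin
    Σ≤ n f + f (suc n)                  ≈⟨ +-comm _ _ ⟩
    f (suc n) + Σ≤ n f                  ≈⟨ +-congˡ (Σ≤-reverse n f) ⟩
    f (suc n) + Σ≤ n (λ i → f (n ∸ i))  ≈⟨ Σ≤-suc-head n (λ i → f (suc n ∸ i)) ⟨
    Σ≤ (suc n) (λ i → f (suc n ∸ i))    ∎

  Σ≤-comm : ∀ m n (f : ℕ → ℕ → Carrier) →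
            Σ≤ m (λ i → Σ≤ n (λ j → f i j)) ≈ Σ≤ n (λ j → Σ≤ m (λ i → f i j))
  Σ≤-comm zero    n f = refl
  Σ≤-comm (suc m) n f = trans (+-congʳ (Σ≤-comm m n f)) (sym (Σ≤-distrib-+ n _ _))

module PowerSeries {c ℓ} (R : CommutativeRing c ℓ) where
  open CommutativeRing R hiding (zero)
  open Poly R using (Σ≤)
  open FiniteSums R
  open SetoidReasoning setoid

  Seq : Set c
  Seq = ℕ → Carrier

  _≋_ : Seq → Seq → Set ℓ
  f ≋ g = ∀ m → f m ≈ g m

  _⊞_ : Seq → Seq → Seq
  (f ⊞ g) m = f m + g m

  ⊟_ : Seq → Seq
  (⊟ f) m = - f m

  𝟘 : Seq
  𝟘 _ = 0#

  𝟏 : Seq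
  𝟏 zero    = 1#
  𝟏 (suc _) = 0#

  _⊠_ : Seq → Seq → Seq
  (f ⊠ g) m = Σ≤ m (λ i → f i * g (m ∸ i))

  shift : Seq → Seq
  shift f m = f (suc m)

  _⋆_ : Carrier → Seq → Seq
  (u ⋆ f) m = u * f m

  ⊠-cong : ∀ {f f′ g g′} → f ≋ f′ → g ≋ g′ → (f ⊠ g) ≋ (f′ ⊠ g′)
  ⊠-cong f≋f′ g≋g′ m = Σ≤-cong′ m λ i → *-cong (f≋f′ i) (g≋g′ (m ∸ i))

  ⊠-suc : ∀ f g m → (f ⊠ g) (suc m) ≈ f 0 * g (suc m) + (shift f ⊠ g) m
  ⊠-suc f g m = Σ≤-suc-head m _

  ⊠-distribʳ : ∀ f g h → ((f ⊞ g) ⊠ h) ≋ ((f ⊠ h) ⊞ (g ⊠ h))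
  ⊠-distribʳ f g h m = trans (Σ≤-cong′ m λ _ → distribʳ _ _ _) (Σ≤-distrib-+ m _ _)

  ⊠-distribˡ : ∀ f g h → (h ⊠ (f ⊞ g)) ≋ ((h ⊠ f) ⊞ (h ⊠ g))
  ⊠-distribˡ f g h m = trans (Σ≤-cong′ m λ _ → distribˡ _ _ _) (Σ≤-distrib-+ m _ _)

  ⋆-⊠ : ∀ u f g → ((u ⋆ f) ⊠ g) ≋ (u ⋆ (f ⊠ g))
  ⋆-⊠ u f g m = trans (Σ≤-cong′ m λ _ → *-assoc _ _ _) (sym (*-distribˡ-Σ≤ m u _))

  ⊠-comm : ∀ f g → (f ⊠ g) ≋ (g ⊠ f)
  ⊠-comm f g m = trans (Σ≤-reverse m _) (Σ≤-cong m λ i i≤m →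
    trans (*-comm _ _) (*-congʳ (reflexive (≡.cong g (ℕₚ.m∸[m∸n]≡n i≤m)))))

  ⊠-assoc : ∀ m f g h → ((f ⊠ g) ⊠ h) m ≈ (f ⊠ (g ⊠ h)) m
  ⊠-assoc zero    f g h = *-assoc _ _ _
  ⊠-assoc (suc m) f g h = begin
    ((f ⊠ g) ⊠ h) (suc m)
      ≈⟨ ⊠-suc (f ⊠ g) h m ⟩
    (f 0 * g 0) * h (suc m) + (shift (f ⊠ g) ⊠ h) m
      ≈⟨ +-congˡ (⊠-cong {g = h} (⊠-suc f g) (λ _ → refl) m) ⟩
    (f 0 * g 0) * h (suc m) + (((f 0 ⋆ shift g) ⊞ (shift f ⊠ g)) ⊠ h) m
      ≈⟨ +-congˡ (trans (⊠-distribʳ _ _ h m) (+-cong (⋆-⊠ (f 0) (shift g) h m) (⊠-assoc m (shift f) g h))) ⟩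
    (f 0 * g 0) * h (suc m) + (f 0 * (shift g ⊠ h) m + (shift f ⊠ (g ⊠ h)) m)
      ≈⟨ sym (+-assoc _ _ _) ⟩
    ((f 0 * g 0) * h (suc m) + f 0 * (shift g ⊠ h) m) + (shift f ⊠ (g ⊠ h)) m
      ≈⟨ +-congʳ (trans (+-congʳ (*-assoc _ _ _)) (sym (distribˡ _ _ _))) ⟩
    f 0 * (g 0 * h (suc m) + (shift g ⊠ h) m) + (shift f ⊠ (g ⊠ h)) m
      ≈⟨ +-congʳ (*-congˡ (⊠-suc g h m)) ⟨
    f 0 * (g ⊠ h) (suc m) + (shift f ⊠ (g ⊠ h)) m
      ≈⟨ ⊠-suc f (g ⊠ h) m ⟨
    (f ⊠ (g ⊠ h)) (suc m) ∎

  ⊠-identityˡ : ∀ f → (𝟏 ⊠ f) ≋ f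
  ⊠-identityˡ f zero    = *-identityˡ _
  ⊠-identityˡ f (suc m) =
    trans (⊠-suc 𝟏 f m) (trans (+-cong (*-identityˡ _) (Σ≤-zero m λ _ _ → zeroˡ _)) (+-identityʳ _))

  powerSeriesRing : CommutativeRing c ℓ
  powerSeriesRing = record
    { Carrier = Seq ; _≈_ = _≋_ ; _+_ = _⊞_ ; _*_ = _⊠_ ; -_ = ⊟_ ; 0# = 𝟘 ; 1# = 𝟏
    ; isCommutativeRing = record
      { isRing = record
        { +-isAbelianGroup = record
          { isGroup = record
            { isMonoid = record
              { isSemigroup = record
                { isMagma = record
                  { isEquivalence = record
                    { refl = λ _ → refl ; sym = λ e m → sym (e m) ; trans = λ e e′ m → trans (e m) (e′ m) }
                  ; ∙-cong = λ e e′ m → +-cong (e m) (e′ m) }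
                ; assoc = λ _ _ _ _ → +-assoc _ _ _ }
              ; identity = (λ _ _ → +-identityˡ _) , (λ _ _ → +-identityʳ _) }
            ; inverse = (λ _ _ → -‿inverseˡ _) , (λ _ _ → -‿inverseʳ _)
            ; ⁻¹-cong = λ e m → -‿cong (e m) }
          ; comm = λ _ _ _ → +-comm _ _ }
        ; *-cong = ⊠-cong
        ; *-assoc = λ f g h m → ⊠-assoc m f g h
        ; *-identity = ⊠-identityˡ , (λ f m → trans (⊠-comm f 𝟏 m) (⊠-identityˡ f m))
        ; distrib = (λ h f g → ⊠-distribˡ f g h) , (λ h f g → ⊠-distribʳ f g h) }
      ; *-comm = ⊠-comm }
    }

  Σ≤-pointwise : ∀ n (h : ℕ → Seq) a → Poly.Σ≤ powerSeriesRing n h a ≈ Σ≤ n (λ i → h i a)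
  Σ≤-pointwise zero    h a = refl
  Σ≤-pointwise (suc n) h a = +-congʳ (Σ≤-pointwise n h a)

module Series {c ℓ} (R : CommutativeRing c ℓ) where
  open CommutativeRing R hiding (zero)
  open Poly R
  open FiniteSums R
  open import Algebra.Properties.Ring ring using (-‿distribˡ-*)

  -- A series is a T-sequence of x-sequences of y-sequences, and ⊛ is the product of the
  -- iterated power-series ring up to the order of summation (⊛≐*), whence its ring laws.
  R⟦T,x,y⟧ : CommutativeRing c ℓ
  R⟦T,x,y⟧ = PS.powerSeriesRing (PS.powerSeriesRing (PS.powerSeriesRing R))
    where module PS = PowerSeries

  module 𝕊 = CommutativeRing R⟦T,x,y⟧
  module ≐-Reasoning = SetoidReasoning 𝕊.setoid

  ⊛≐* : ∀ F G → (F ⊛ G) ≐ (F 𝕊.* G)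
  ⊛≐* F G m a b = sym (begin
    (F 𝕊.* G) m a b
      ≈⟨ PowerSeries.Σ≤-pointwise R₁ m _ a b ⟩
    Poly.Σ≤ R₁ m (λ m₁ → PowerSeries._⊠_ R₁ (F m₁) (G (m ∸ m₁)) a) b
      ≈⟨ PowerSeries.Σ≤-pointwise R m _ b ⟩
    Σ≤ m (λ m₁ → Poly.Σ≤ R₁ a (λ a₁ → PowerSeries._⊠_ R (F m₁ a₁) (G (m ∸ m₁) (a ∸ a₁))) b)
      ≈⟨ Σ≤-cong′ m (λ m₁ → PowerSeries.Σ≤-pointwise R a _ b) ⟩
    (F ⊛ G) m a b ∎)
    where
    R₁ = PowerSeries.powerSeriesRing R
    open SetoidReasoning setoid

  ⊛-cong : ∀ {F F′ G G′} → F ≐ F′ → G ≐ G′ → (F ⊛ G) ≐ (F′ ⊛ G′)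
  ⊛-cong {F} {F′} {G} {G′} F≐F′ G≐G′ = begin
    F ⊛ G      ≈⟨ ⊛≐* F G ⟩
    F 𝕊.* G    ≈⟨ 𝕊.*-cong F≐F′ G≐G′ ⟩
    F′ 𝕊.* G′  ≈⟨ ⊛≐* F′ G′ ⟨
    F′ ⊛ G′    ∎
    where open ≐-Reasoning

  ⊛-congˡ : ∀ {F G G′} → G ≐ G′ → (F ⊛ G) ≐ (F ⊛ G′)
  ⊛-congˡ {F} = ⊛-cong (𝕊.refl {F})

  ⊛-congʳ : ∀ {F F′ G} → F ≐ F′ → (F ⊛ G) ≐ (F′ ⊛ G)
  ⊛-congʳ {G = G} F≐F′ = ⊛-cong F≐F′ (𝕊.refl {G})

  ⊛-comm : ∀ F G → (F ⊛ G) ≐ (G ⊛ F)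
  ⊛-comm F G = begin
    F ⊛ G    ≈⟨ ⊛≐* F G ⟩
    F 𝕊.* G  ≈⟨ 𝕊.*-comm F G ⟩
    G 𝕊.* F  ≈⟨ ⊛≐* G F ⟨
    G ⊛ F    ∎
    where open ≐-Reasoning

  ⊛-assoc : ∀ F G H → ((F ⊛ G) ⊛ H) ≐ (F ⊛ (G ⊛ H))
  ⊛-assoc F G H = begin
    (F ⊛ G) ⊛ H          ≈⟨ ⊛≐* (F ⊛ G) H ⟩
    (F ⊛ G) 𝕊.* H        ≈⟨ 𝕊.*-cong (⊛≐* F G) (𝕊.refl {H}) ⟩
    (F 𝕊.* G) 𝕊.* H      ≈⟨ 𝕊.*-assoc F G H ⟩
    F 𝕊.* (G 𝕊.* H)      ≈⟨ 𝕊.*-congˡ (⊛≐* G H) ⟨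
    F 𝕊.* (G ⊛ H)        ≈⟨ ⊛≐* F (G ⊛ H) ⟨
    F ⊛ (G ⊛ H)          ∎
    where open ≐-Reasoning

  ⊛-distribʳ : ∀ F G H → ((F ⊕ G) ⊛ H) ≐ ((F ⊛ H) ⊕ (G ⊛ H))
  ⊛-distribʳ F G H = begin
    (F ⊕ G) ⊛ H                ≈⟨ ⊛≐* (F ⊕ G) H ⟩
    (F ⊕ G) 𝕊.* H              ≈⟨ 𝕊.distribʳ H F G ⟩
    (F 𝕊.* H) ⊕ (G 𝕊.* H)      ≈⟨ 𝕊.+-cong (⊛≐* F H) (⊛≐* G H) ⟨
    (F ⊛ H) ⊕ (G ⊛ H)          ∎
    where open ≐-Reasoning

  ⊛-distribˡ : ∀ F G H → (H ⊛ (F ⊕ G)) ≐ ((H ⊛ F) ⊕ (H ⊛ G))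
  ⊛-distribˡ F G H = begin
    H ⊛ (F ⊕ G)                ≈⟨ ⊛≐* H (F ⊕ G) ⟩
    H 𝕊.* (F ⊕ G)              ≈⟨ 𝕊.distribˡ H F G ⟩
    (H 𝕊.* F) ⊕ (H 𝕊.* G)      ≈⟨ 𝕊.+-cong (⊛≐* H F) (⊛≐* H G) ⟨
    (H ⊛ F) ⊕ (H ⊛ G)          ∎
    where open ≐-Reasoning

  𝟙≐1 : 𝟙 ≐ 𝕊.1#
  𝟙≐1 zero    zero    zero    = refl
  𝟙≐1 zero    zero    (suc b) = refl
  𝟙≐1 zero    (suc a) b       = refl
  𝟙≐1 (suc m) a       b       = refl

  ⊛-identityˡ : ∀ F → (𝟙 ⊛ F) ≐ F
  ⊛-identityˡ F = begin
    𝟙 ⊛ F        ≈⟨ ⊛≐* 𝟙 F ⟩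
    𝟙 𝕊.* F      ≈⟨ 𝕊.*-cong 𝟙≐1 (𝕊.refl {F}) ⟩
    𝕊.1# 𝕊.* F   ≈⟨ 𝕊.*-identityˡ F ⟩
    F            ∎
    where open ≐-Reasoning

  ⊛-identityʳ : ∀ F → (F ⊛ 𝟙) ≐ F
  ⊛-identityʳ F = 𝕊.trans (⊛-comm F 𝟙) (⊛-identityˡ F)

  ·-⊛ : ∀ u F G → ((u · F) ⊛ G) ≐ (u · (F ⊛ G))
  ·-⊛ u F G m a b = sym (
    trans (*-distribˡ-Σ≤ m u _) (Σ≤-cong′ m λ _ →
    trans (*-distribˡ-Σ≤ a u _) (Σ≤-cong′ a λ _ →
    trans (*-distribˡ-Σ≤ b u _) (Σ≤-cong′ b λ _ → sym (*-assoc _ _ _)))))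

  ⊛-· : ∀ u F G → (F ⊛ (u · G)) ≐ (u · (F ⊛ G))
  ⊛-· u F G = begin
    F ⊛ (u · G)    ≈⟨ ⊛-comm F (u · G) ⟩
    (u · G) ⊛ F    ≈⟨ ·-⊛ u G F ⟩
    u · (G ⊛ F)    ≈⟨ (λ m a b → *-congˡ (⊛-comm G F m a b)) ⟩
    u · (F ⊛ G)    ∎
    where open ≐-Reasoning

  ⊝-⊛ : ∀ F G → ((⊝ F) ⊛ G) ≐ (⊝ (F ⊛ G))
  ⊝-⊛ F G m a b = sym (
    trans (-‿distrib-Σ≤ m _) (Σ≤-cong′ m λ _ →
    trans (-‿distrib-Σ≤ a _) (Σ≤-cong′ a λ _ →
    trans (-‿distrib-Σ≤ b _) (Σ≤-cong′ b λ _ → -‿distribˡ-* _ _))))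

  ·-cong : ∀ u {F G} → F ≐ G → (u · F) ≐ (u · G)
  ·-cong u F≐G m a b = *-congˡ (F≐G m a b)

  ^^-cong : ∀ {F G} k → F ≐ G → (F ^^ k) ≐ (G ^^ k)
  ^^-cong zero    _   = 𝕊.refl {𝟙}
  ^^-cong (suc k) F≐G = ⊛-cong F≐G (^^-cong k F≐G)

  ·-^^ : ∀ u F k → ((u · F) ^^ k) ≐ (pw u k · (F ^^ k))
  ·-^^ u F zero    m a b = sym (*-identityˡ _)
  ·-^^ u F (suc k) = begin
    (u · F) ⊛ ((u · F) ^^ k)            ≈⟨ ⊛-congˡ (·-^^ u F k) ⟩
    (u · F) ⊛ (pw u k · (F ^^ k))       ≈⟨ ·-⊛ u F (pw u k · (F ^^ k)) ⟩
    u · (F ⊛ (pw u k · (F ^^ k)))       ≈⟨ ·-cong u (⊛-· (pw u k) F (F ^^ k)) ⟩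
    u · (pw u k · (F ⊛ (F ^^ k)))       ≈⟨ (λ m a b → sym (*-assoc _ _ _)) ⟩
    (u * pw u k) · (F ⊛ (F ^^ k))       ∎
    where open ≐-Reasoning

  Σs-pointwise : ∀ n (F : ℕ → Ser) m a b → Σs n F m a b ≈ Σ≤ n (λ i → F i m a b)
  Σs-pointwise zero    F m a b = refl
  Σs-pointwise (suc n) F m a b = +-congʳ (Σs-pointwise n F m a b)

  coeff-cong : ∀ (F : Ser) {m m′ a a′ b b′} → m ≡ m′ → a ≡ a′ → b ≡ b′ → F m a b ≈ F m′ a′ b′
  coeff-cong F ≡.refl ≡.refl ≡.refl = refl

module Monomials {c ℓ} (R : CommutativeRing c ℓ) where
  open CommutativeRing R hiding (zero)
  open Poly R
  open FiniteSums R
  open Series R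
  open SetoidReasoning setoid

  mono-self : ∀ u m a b → mono u m a b m a b ≈ u
  mono-self u m a b rewrite ≡ᵇ-refl m | ≡ᵇ-refl a | ≡ᵇ-refl b = refl

  mono-elsewhere : ∀ u m a b m′ a′ b′ → (m′ ≢ m ⊎ a′ ≢ a ⊎ b′ ≢ b) → mono u m a b m′ a′ b′ ≈ 0#
  mono-elsewhere u m a b m′ a′ b′ (inj₁ m′≢m) rewrite ≢⇒≡ᵇ-false m m′ (m′≢m ∘ ≡.sym) = refl
  mono-elsewhere u m a b m′ a′ b′ (inj₂ (inj₁ a′≢a)) with m ≡ᵇ m′
  ... | true rewrite ≢⇒≡ᵇ-false a a′ (a′≢a ∘ ≡.sym) = refl
  ... | false = refl
  mono-elsewhere u m a b m′ a′ b′ (inj₂ (inj₂ b′≢b)) with m ≡ᵇ m′ | a ≡ᵇ a′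
  ... | true  | true rewrite ≢⇒≡ᵇ-false b b′ (b′≢b ∘ ≡.sym) = refl
  ... | true  | false = refl
  ... | false | _     = refl

  mono-⊛ : ∀ u m₀ a₀ b₀ F m a b →
           (mono u m₀ a₀ b₀ ⊛ F) (m₀ ℕ.+ m) (a₀ ℕ.+ a) (b₀ ℕ.+ b) ≈ u * F m a b
  mono-⊛ u m₀ a₀ b₀ F m a b = begin
    (mono u m₀ a₀ b₀ ⊛ F) (m₀ ℕ.+ m) (a₀ ℕ.+ a) (b₀ ℕ.+ b)
      ≈⟨ Σ≤-single _ m₀ (ℕₚ.m≤m+n m₀ m) (λ m₁ _ m₁≢m₀ →
           Σ≤-zero (a₀ ℕ.+ a) λ a₁ _ → Σ≤-zero (b₀ ℕ.+ b) λ b₁ _ → vanish (inj₁ m₁≢m₀)) ⟩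
    Σ≤ (a₀ ℕ.+ a) (λ a₁ → Σ≤ (b₀ ℕ.+ b) (λ b₁ → mono u m₀ a₀ b₀ m₀ a₁ b₁ * F′ a₁ b₁))
      ≈⟨ Σ≤-single _ a₀ (ℕₚ.m≤m+n a₀ a) (λ a₁ _ a₁≢a₀ → Σ≤-zero (b₀ ℕ.+ b) λ b₁ _ →
           vanish (inj₂ (inj₁ a₁≢a₀))) ⟩
    Σ≤ (b₀ ℕ.+ b) (λ b₁ → mono u m₀ a₀ b₀ m₀ a₀ b₁ * F′ a₀ b₁)
      ≈⟨ Σ≤-single _ b₀ (ℕₚ.m≤m+n b₀ b) (λ b₁ _ b₁≢b₀ → vanish (inj₂ (inj₂ b₁≢b₀))) ⟩
    mono u m₀ a₀ b₀ m₀ a₀ b₀ * F′ a₀ b₀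
      ≈⟨ *-cong (mono-self u m₀ a₀ b₀)
                (coeff-cong F (ℕₚ.m+n∸m≡n m₀ m) (ℕₚ.m+n∸m≡n a₀ a) (ℕₚ.m+n∸m≡n b₀ b)) ⟩
    u * F m a b ∎
    where
    F′ : ℕ → ℕ → Carrier
    F′ a₁ b₁ = F (m₀ ℕ.+ m ∸ m₀) (a₀ ℕ.+ a ∸ a₁) (b₀ ℕ.+ b ∸ b₁)
    vanish : ∀ {m₁ a₁ b₁ G} → (m₁ ≢ m₀ ⊎ a₁ ≢ a₀ ⊎ b₁ ≢ b₀) → mono u m₀ a₀ b₀ m₁ a₁ b₁ * G ≈ 0#
    vanish off = trans (*-congʳ (mono-elsewhere u m₀ a₀ b₀ _ _ _ off)) (zeroˡ _)

  mono-⊛-below : ∀ u m₀ a₀ b₀ F m a b → (m < m₀ ⊎ a < a₀ ⊎ b < b₀) → (mono u m₀ a₀ b₀ ⊛ F) m a b ≈ 0#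
  mono-⊛-below u m₀ a₀ b₀ F m a b below =
    Σ≤-zero m λ _ m₁≤m → Σ≤-zero a λ _ a₁≤a → Σ≤-zero b λ _ b₁≤b →
      trans (*-congʳ (mono-elsewhere u m₀ a₀ b₀ _ _ _ (off below m₁≤m a₁≤a b₁≤b))) (zeroˡ _)
    where
    off : ∀ {m₁ a₁ b₁} → (m < m₀ ⊎ a < a₀ ⊎ b < b₀) → m₁ ≤ m → a₁ ≤ a → b₁ ≤ b →
          (m₁ ≢ m₀ ⊎ a₁ ≢ a₀ ⊎ b₁ ≢ b₀)
    off (inj₁ m<m₀)        m₁≤m _ _ = inj₁ (ℕₚ.<⇒≢ (ℕₚ.≤-<-trans m₁≤m m<m₀))
    off (inj₂ (inj₁ a<a₀)) _ a₁≤a _ = inj₂ (inj₁ (ℕₚ.<⇒≢ (ℕₚ.≤-<-trans a₁≤a a<a₀)))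
    off (inj₂ (inj₂ b<b₀)) _ _ b₁≤b = inj₂ (inj₂ (ℕₚ.<⇒≢ (ℕₚ.≤-<-trans b₁≤b b<b₀)))

  𝕏⊛-suc : ∀ F m a b → (𝕏 ⊛ F) m (suc a) b ≈ F m a b
  𝕏⊛-suc F m a b = trans (mono-⊛ 1# 0 1 0 F m a b) (*-identityˡ _)

  𝕏⊛-zero : ∀ F m b → (𝕏 ⊛ F) m 0 b ≈ 0#
  𝕏⊛-zero F m b = mono-⊛-below 1# 0 1 0 F m 0 b (inj₂ (inj₁ (s≤s z≤n)))

  𝕐⊛-suc : ∀ F m a b → (𝕐 ⊛ F) m a (suc b) ≈ F m a b
  𝕐⊛-suc F m a b = trans (mono-⊛ 1# 0 0 1 F m a b) (*-identityˡ _)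

  𝕐⊛-zero : ∀ F m a → (𝕐 ⊛ F) m a 0 ≈ 0#
  𝕐⊛-zero F m a = mono-⊛-below 1# 0 0 1 F m a 0 (inj₂ (inj₂ (s≤s z≤n)))

  𝕋⊛-suc : ∀ F m a b → (𝕋 ⊛ F) (suc m) a b ≈ F m a b
  𝕋⊛-suc F m a b = trans (mono-⊛ 1# 1 0 0 F m a b) (*-identityˡ _)

  𝕋⊛-zero : ∀ F a b → (𝕋 ⊛ F) 0 a b ≈ 0#
  𝕋⊛-zero F a b = mono-⊛-below 1# 1 0 0 F 0 a b (inj₁ (s≤s z≤n))

  𝕏^^⊛-shift : ∀ i F m a b → ((𝕏 ^^ i) ⊛ F) m (i ℕ.+ a) b ≈ F m a b
  𝕏^^⊛-shift zero    F m a b = ⊛-identityˡ F m a b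
  𝕏^^⊛-shift (suc i) F m a b =
    trans (⊛-assoc 𝕏 (𝕏 ^^ i) F m (suc (i ℕ.+ a)) b)
          (trans (𝕏⊛-suc ((𝕏 ^^ i) ⊛ F) m (i ℕ.+ a) b) (𝕏^^⊛-shift i F m a b))

  𝕏^^⊛-below : ∀ i F m a b → a < i → ((𝕏 ^^ i) ⊛ F) m a b ≈ 0#
  𝕏^^⊛-below (suc i) F m zero    b _ = trans (⊛-assoc 𝕏 (𝕏 ^^ i) F m 0 b) (𝕏⊛-zero ((𝕏 ^^ i) ⊛ F) m b)
  𝕏^^⊛-below (suc i) F m (suc a) b (s≤s a<i) =
    trans (⊛-assoc 𝕏 (𝕏 ^^ i) F m (suc a) b) (trans (𝕏⊛-suc ((𝕏 ^^ i) ⊛ F) m a b) (𝕏^^⊛-below i F m a b a<i))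

  𝕐^^⊛-shift : ∀ i F m a b → ((𝕐 ^^ i) ⊛ F) m a (i ℕ.+ b) ≈ F m a b
  𝕐^^⊛-shift zero    F m a b = ⊛-identityˡ F m a b
  𝕐^^⊛-shift (suc i) F m a b =
    trans (⊛-assoc 𝕐 (𝕐 ^^ i) F m a (suc (i ℕ.+ b)))
          (trans (𝕐⊛-suc ((𝕐 ^^ i) ⊛ F) m a (i ℕ.+ b)) (𝕐^^⊛-shift i F m a b))

  𝕐^^⊛-below : ∀ i F m a b → b < i → ((𝕐 ^^ i) ⊛ F) m a b ≈ 0#
  𝕐^^⊛-below (suc i) F m a zero    _ = trans (⊛-assoc 𝕐 (𝕐 ^^ i) F m a 0) (𝕐⊛-zero ((𝕐 ^^ i) ⊛ F) m a)
  𝕐^^⊛-below (suc i) F m a (suc b) (s≤s b<i) =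
    trans (⊛-assoc 𝕐 (𝕐 ^^ i) F m a (suc b)) (trans (𝕐⊛-suc ((𝕐 ^^ i) ⊛ F) m a b) (𝕐^^⊛-below i F m a b b<i))

module Numerals {c ℓ} (R : CommutativeRing c ℓ) where
  open CommutativeRing R hiding (zero)
  open Poly R
  open SetoidReasoning setoid
  open import Algebra.Properties.CommutativeSemigroup *-commutativeSemigroup using (interchange)

  fromℕ-+ : ∀ a b → fromℕ (a ℕ.+ b) ≈ fromℕ a + fromℕ b
  fromℕ-+ zero    b = sym (+-identityˡ _)
  fromℕ-+ (suc a) b = trans (+-congˡ (fromℕ-+ a b)) (sym (+-assoc _ _ _))

  fromℕ-* : ∀ a b → fromℕ (a ℕ.* b) ≈ fromℕ a * fromℕ b
  fromℕ-* zero    b = sym (zeroˡ _)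
  fromℕ-* (suc a) b = begin
    fromℕ (b ℕ.+ a ℕ.* b)             ≈⟨ fromℕ-+ b (a ℕ.* b) ⟩
    fromℕ b + fromℕ (a ℕ.* b)         ≈⟨ +-cong (sym (*-identityˡ _)) (fromℕ-* a b) ⟩
    1# * fromℕ b + fromℕ a * fromℕ b  ≈⟨ distribʳ _ _ _ ⟨
    (1# + fromℕ a) * fromℕ b          ∎

  pw-+ : ∀ u a b → pw u (a ℕ.+ b) ≈ pw u a * pw u b
  pw-+ u zero    b = sym (*-identityˡ _)
  pw-+ u (suc a) b = trans (*-congˡ (pw-+ u a b)) (sym (*-assoc _ _ _))

  pw-* : ∀ u v k → pw (u * v) k ≈ pw u k * pw v k
  pw-* u v zero    = sym (*-identityˡ _)
  pw-* u v (suc k) = trans (*-congˡ (pw-* u v k)) (interchange _ _ _ _)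

  pw-1# : ∀ k → pw 1# k ≈ 1#
  pw-1# zero    = refl
  pw-1# (suc k) = trans (*-identityˡ _) (pw-1# k)

  pw-cong : ∀ {u v} k → u ≈ v → pw u k ≈ pw v k
  pw-cong zero    _   = refl
  pw-cong (suc k) u≈v = *-cong u≈v (pw-cong k u≈v)

  pw-fromℕ : ∀ a k → pw (fromℕ a) k ≈ fromℕ (a ℕ.^ k)
  pw-fromℕ a zero    = sym (+-identityʳ _)
  pw-fromℕ a (suc k) = trans (*-congˡ (pw-fromℕ a k)) (sym (fromℕ-* a (a ℕ.^ k)))

  pw-two : ∀ k → pw two k ≈ fromℕ (2 ℕ.^ k)
  pw-two k = trans (pw-cong k (+-congˡ (sym (+-identityʳ _)))) (pw-fromℕ 2 k)

module BinomialExpansion {c ℓ} (R : CommutativeRing c ℓ) (γ : CommutativeRing.Carrier R) (e : ℕ) where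
  open CommutativeRing R hiding (zero)
  open Poly R
  open Series R
  open Monomials R
  open Numerals R
  open SetoidReasoning setoid
  open import Algebra.Properties.CommutativeSemigroup *-commutativeSemigroup using (x∙yz≈y∙xz)

  Tᵉx : Ser
  Tᵉx = mono 1# e 1 0

  L : Ser
  L = (γ · 𝕐) ⊕ Tᵉx

  L⊛ : ∀ F m a b → (L ⊛ F) m a b ≈ γ * (𝕐 ⊛ F) m a b + (Tᵉx ⊛ F) m a b
  L⊛ F m a b = trans (⊛-distribʳ (γ · 𝕐) Tᵉx F m a b) (+-congʳ (·-⊛ γ 𝕐 F m a b))

  Tᵉx⊛-suc : ∀ F m a b → (Tᵉx ⊛ F) (e ℕ.+ m) (suc a) b ≈ F m a b
  Tᵉx⊛-suc F m a b = trans (mono-⊛ 1# e 1 0 F m a b) (*-identityˡ _)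

  L^^-off : ∀ k m a b → ¬ (a ℕ.+ b ≡ k × m ≡ a ℕ.* e) → (L ^^ k) m a b ≈ 0#
  L^^-off zero    zero    zero    zero    off = ⊥-elim (off (≡.refl , ≡.refl))
  L^^-off zero    (suc m) a       b       _   = refl
  L^^-off zero    zero    (suc a) b       _   = refl
  L^^-off zero    zero    zero    (suc b) _   = refl
  L^^-off (suc k) m       a       b       off =
    trans (L⊛ (L ^^ k) m a b) (trans (+-cong (trans (*-congˡ (𝕐-part b off)) (zeroʳ γ)) (Tᵉx-part a off))
                                     (+-identityˡ 0#))
    where
    𝕐-part : ∀ b → ¬ (a ℕ.+ b ≡ suc k × m ≡ a ℕ.* e) → (𝕐 ⊛ (L ^^ k)) m a b ≈ 0#
    𝕐-part zero     _   = 𝕐⊛-zero (L ^^ k) m a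
    𝕐-part (suc b′) off = trans (𝕐⊛-suc (L ^^ k) m a b′) (L^^-off k m a b′
      λ (a+b′≡k , m≡ae) → off (≡.trans (ℕₚ.+-suc a b′) (≡.cong suc a+b′≡k) , m≡ae))
    Tᵉx-part : ∀ a → ¬ (a ℕ.+ b ≡ suc k × m ≡ a ℕ.* e) → (Tᵉx ⊛ (L ^^ k)) m a b ≈ 0#
    Tᵉx-part zero     _   = mono-⊛-below 1# e 1 0 (L ^^ k) m 0 b (inj₂ (inj₁ (s≤s z≤n)))
    Tᵉx-part (suc a′) off with e ℕₚ.≤? m
    ... | no  e≰m = mono-⊛-below 1# e 1 0 (L ^^ k) m (suc a′) b (inj₁ (ℕₚ.≰⇒> e≰m))
    ... | yes e≤m = begin
      (Tᵉx ⊛ (L ^^ k)) m (suc a′) b            ≡⟨ ≡.cong (λ m → (Tᵉx ⊛ (L ^^ k)) m (suc a′) b) m≡e+m′ ⟩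
      (Tᵉx ⊛ (L ^^ k)) (e ℕ.+ m′) (suc a′) b   ≈⟨ Tᵉx⊛-suc (L ^^ k) m′ a′ b ⟩
      (L ^^ k) m′ a′ b                         ≈⟨ L^^-off k m′ a′ b (λ (a′+b≡k , m′≡a′e) →
                                                    off (≡.cong suc a′+b≡k , ≡.trans m≡e+m′ (≡.cong (e ℕ.+_) m′≡a′e))) ⟩
      0#                                       ∎
      where
      m′ = m ∸ e
      m≡e+m′ : m ≡ e ℕ.+ m′
      m≡e+m′ = ≡.sym (ℕₚ.m+[n∸m]≡n e≤m)

  L^^-coeff : ∀ k a b → a ℕ.+ b ≡ k → (L ^^ k) (a ℕ.* e) a b ≈ fromℕ (k C a) * pw γ b
  L^^-coeff zero    zero    zero    _  = sym (trans (*-identityʳ _) (+-identityʳ 1#))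
  L^^-coeff (suc k) zero    (suc b) ab = begin
    (L ^^ suc k) 0 0 (suc b)                                   ≈⟨ L⊛ (L ^^ k) 0 0 (suc b) ⟩
    γ * (𝕐 ⊛ (L ^^ k)) 0 0 (suc b) + (Tᵉx ⊛ (L ^^ k)) 0 0 (suc b)
      ≈⟨ +-cong (*-congˡ (trans (𝕐⊛-suc (L ^^ k) 0 0 b) (L^^-coeff k 0 b (ℕₚ.suc-injective ab))))
                (mono-⊛-below 1# e 1 0 (L ^^ k) 0 0 (suc b) (inj₂ (inj₁ (s≤s z≤n)))) ⟩
    γ * (fromℕ 1 * pw γ b) + 0#                                ≈⟨ +-identityʳ _ ⟩
    γ * (fromℕ 1 * pw γ b)                                     ≈⟨ x∙yz≈y∙xz γ _ _ ⟩
    fromℕ 1 * pw γ (suc b)                                     ∎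
  L^^-coeff (suc k) (suc a) zero    ab = begin
    (L ^^ suc k) (suc a ℕ.* e) (suc a) 0                       ≈⟨ L⊛ (L ^^ k) (suc a ℕ.* e) (suc a) 0 ⟩
    γ * (𝕐 ⊛ (L ^^ k)) (suc a ℕ.* e) (suc a) 0 + (Tᵉx ⊛ (L ^^ k)) (e ℕ.+ a ℕ.* e) (suc a) 0
      ≈⟨ +-cong (trans (*-congˡ (𝕐⊛-zero (L ^^ k) (suc a ℕ.* e) (suc a))) (zeroʳ γ))
                (trans (Tᵉx⊛-suc (L ^^ k) (a ℕ.* e) a 0) (L^^-coeff k a 0 a+0≡k)) ⟩
    0# + fromℕ (k C a) * pw γ 0                                ≈⟨ +-identityˡ _ ⟩
    fromℕ (k C a) * pw γ 0                                     ≈⟨ *-congʳ (reflexive (≡.cong fromℕ kCa≡[1+k]C[1+a])) ⟩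
    fromℕ (suc k C suc a) * pw γ 0                             ∎
    where
    a+0≡k : a ℕ.+ 0 ≡ k
    a+0≡k = ℕₚ.suc-injective ab
    k≡a : k ≡ a
    k≡a = ≡.trans (≡.sym a+0≡k) (ℕₚ.+-identityʳ a)
    kCa≡[1+k]C[1+a] : k C a ≡ suc k C suc a
    kCa≡[1+k]C[1+a] = ≡.trans (≡.sym (ℕₚ.+-identityʳ (k C a)))
      (≡.trans (≡.cong (k C a ℕ.+_) (≡.sym (k>n⇒nCk≡0 {k} {suc a} (ℕₚ.≤-reflexive (≡.cong suc k≡a)))))
               (nCk+nC[k+1]≡[n+1]C[k+1] k a))
  L^^-coeff (suc k) (suc a) (suc b) ab = begin
    (L ^^ suc k) (suc a ℕ.* e) (suc a) (suc b)                 ≈⟨ L⊛ (L ^^ k) (suc a ℕ.* e) (suc a) (suc b) ⟩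
    γ * (𝕐 ⊛ (L ^^ k)) (suc a ℕ.* e) (suc a) (suc b) + (Tᵉx ⊛ (L ^^ k)) (e ℕ.+ a ℕ.* e) (suc a) (suc b)
      ≈⟨ +-cong (*-congˡ (trans (𝕐⊛-suc (L ^^ k) (suc a ℕ.* e) (suc a) b) (L^^-coeff k (suc a) b [1+a]+b≡k)))
                (trans (Tᵉx⊛-suc (L ^^ k) (a ℕ.* e) a (suc b)) (L^^-coeff k a (suc b) a+[1+b]≡k)) ⟩
    γ * (fromℕ (k C suc a) * pw γ b) + fromℕ (k C a) * pw γ (suc b)
      ≈⟨ +-congʳ (x∙yz≈y∙xz γ _ _) ⟩
    fromℕ (k C suc a) * pw γ (suc b) + fromℕ (k C a) * pw γ (suc b)
      ≈⟨ trans (+-comm _ _) (sym (distribʳ _ _ _)) ⟩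
    (fromℕ (k C a) + fromℕ (k C suc a)) * pw γ (suc b)
      ≈⟨ *-congʳ (trans (sym (fromℕ-+ (k C a) (k C suc a))) (reflexive (≡.cong fromℕ (nCk+nC[k+1]≡[n+1]C[k+1] k a)))) ⟩
    fromℕ (suc k C suc a) * pw γ (suc b)                       ∎
    where
    a+[1+b]≡k : a ℕ.+ suc b ≡ k
    a+[1+b]≡k = ℕₚ.suc-injective ab
    [1+a]+b≡k : suc a ℕ.+ b ≡ k
    [1+a]+b≡k = ≡.trans (≡.sym (ℕₚ.+-suc a b)) a+[1+b]≡k

  L^^-coeff-at : ∀ k m a b → a ℕ.+ b ≡ k → m ≡ a ℕ.* e → (L ^^ k) m a b ≈ fromℕ (k C a) * pw γ b
  L^^-coeff-at k _ a b ab ≡.refl = L^^-coeff k a b ab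

module Shear {c ℓ} (R : CommutativeRing c ℓ) where
  open CommutativeRing R hiding (zero)
  open Poly R
  open FiniteSums R
  open Series R
  open Monomials R
  open Numerals R
  open SetoidReasoning setoid
  open import Algebra.Properties.Ring ring using (-‿distribʳ-*)
  open import Algebra.Properties.CommutativeSemigroup *-commutativeSemigroup using (x∙yz≈y∙xz)

  -- S F = F(x + y, y): the monomial x^(j+l) y^(k∸l) contributes C(j+l, l) to x^j y^k.
  S : Ser → Ser
  S F m j k = Σ≤ k (λ l → fromℕ ((j ℕ.+ l) C l) * F m (j ℕ.+ l) (k ∸ l))

  S-layer-cong : ∀ F G m m′ → (∀ a b → F m a b ≈ G m′ a b) → ∀ j k → S F m j k ≈ S G m′ j k
  S-layer-cong F G m m′ F≈G j k = Σ≤-cong′ k λ _ → *-congˡ (F≈G _ _)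

  S-cong : ∀ {F G} → F ≐ G → S F ≐ S G
  S-cong {F} {G} F≐G m = S-layer-cong F G m m (F≐G m)

  S-⊕ : ∀ F G → S (F ⊕ G) ≐ (S F ⊕ S G)
  S-⊕ F G m j k = trans (Σ≤-cong′ k λ _ → distribˡ _ _ _) (Σ≤-distrib-+ k _ _)

  S-· : ∀ u F → S (u · F) ≐ (u · S F)
  S-· u F m j k = trans (Σ≤-cong′ k λ _ → x∙yz≈y∙xz _ u _) (sym (*-distribˡ-Σ≤ k u _))

  S-⊝ : ∀ F → S (⊝ F) ≐ (⊝ S F)
  S-⊝ F m j k = trans (Σ≤-cong′ k λ _ → sym (-‿distribʳ-* _ _)) (sym (-‿distrib-Σ≤ k _))

  S-𝟙 : S 𝟙 ≐ 𝟙
  S-𝟙 (suc m) j       k       = Σ≤-zero k λ _ _ → zeroʳ _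
  S-𝟙 zero    (suc j) k       = Σ≤-zero k λ _ _ → zeroʳ _
  S-𝟙 zero    zero    zero    = trans (*-identityʳ _) (+-identityʳ _)
  S-𝟙 zero    zero    (suc k) =
    trans (Σ≤-suc-head k _) (trans (+-cong (zeroʳ _) (Σ≤-zero k λ _ _ → zeroʳ _)) (+-identityʳ _))

  S-𝕋⊛ : ∀ F → S (𝕋 ⊛ F) ≐ (𝕋 ⊛ S F)
  S-𝕋⊛ F zero    j k = trans (Σ≤-zero k λ l _ → trans (*-congˡ (𝕋⊛-zero F (j ℕ.+ l) (k ∸ l))) (zeroʳ _))
                              (sym (𝕋⊛-zero (S F) j k))
  S-𝕋⊛ F (suc m) j k = trans (Σ≤-cong′ k λ _ → *-congˡ (𝕋⊛-suc F m _ _)) (sym (𝕋⊛-suc (S F) m j k))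

  S-𝕐⊛ : ∀ F → S (𝕐 ⊛ F) ≐ (𝕐 ⊛ S F)
  S-𝕐⊛ F m j zero    = trans (trans (*-congˡ (𝕐⊛-zero F m (j ℕ.+ 0))) (zeroʳ _)) (sym (𝕐⊛-zero (S F) m j))
  S-𝕐⊛ F m j (suc k) = begin
    Σ≤ k term + term (suc k)
      ≈⟨ +-cong (Σ≤-cong k λ l l≤k → *-congˡ (trans (reflexive (≡.cong ((𝕐 ⊛ F) m (j ℕ.+ l)) (ℕₚ.+-∸-assoc 1 l≤k)))
                                                       (𝕐⊛-suc F m (j ℕ.+ l) (k ∸ l))))
                (trans (*-congˡ (trans (reflexive (≡.cong ((𝕐 ⊛ F) m (j ℕ.+ suc k)) (ℕₚ.n∸n≡0 (suc k))))
                                       (𝕐⊛-zero F m (j ℕ.+ suc k))))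
                       (zeroʳ _)) ⟩
    S F m j k + 0#              ≈⟨ +-identityʳ _ ⟩
    S F m j k                   ≈⟨ 𝕐⊛-suc (S F) m j k ⟨
    (𝕐 ⊛ S F) m j (suc k)       ∎
    where
    term : ℕ → Carrier
    term l = fromℕ ((j ℕ.+ l) C l) * (𝕐 ⊛ F) m (j ℕ.+ l) (suc k ∸ l)

  S-𝕏⊛-suc-suc : ∀ F m j k → S (𝕏 ⊛ F) m (suc j) (suc k) ≈ S F m j (suc k) + S F m (suc j) k
  S-𝕏⊛-suc-suc F m j k = begin
    Σ≤ (suc k) term                                      ≈⟨ Σ≤-cong′ (suc k) pascal ⟩
    Σ≤ (suc k) (λ l → termˡ l + termʳ l)                 ≈⟨ Σ≤-distrib-+ (suc k) termˡ termʳ ⟩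
    Σ≤ (suc k) termˡ + Σ≤ (suc k) termʳ                  ≈⟨ +-congˡ (Σ≤-suc-head k termʳ) ⟩
    S F m j (suc k) + (0# + Σ≤ k (λ l → termʳ (suc l)))  ≈⟨ +-congˡ (trans (+-identityˡ _) (Σ≤-cong′ k shifted)) ⟩
    S F m j (suc k) + S F m (suc j) k                    ∎
    where
    term termˡ termʳ : ℕ → Carrier
    term l = fromℕ ((suc j ℕ.+ l) C l) * (𝕏 ⊛ F) m (suc j ℕ.+ l) (suc k ∸ l)
    termˡ l = fromℕ ((j ℕ.+ l) C l) * F m (j ℕ.+ l) (suc k ∸ l)
    termʳ zero    = 0#
    termʳ (suc l) = fromℕ ((j ℕ.+ suc l) C l) * F m (j ℕ.+ suc l) (k ∸ l)
    pascal : ∀ l → term l ≈ termˡ l + termʳ l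
    pascal zero    = trans (*-congˡ (𝕏⊛-suc F m (j ℕ.+ 0) _)) (sym (+-identityʳ _))
    pascal (suc l) = begin
      fromℕ (suc (j ℕ.+ suc l) C suc l) * (𝕏 ⊛ F) m (suc (j ℕ.+ suc l)) (k ∸ l)
        ≈⟨ *-cong (reflexive (≡.cong fromℕ (≡.sym (nCk+nC[k+1]≡[n+1]C[k+1] (j ℕ.+ suc l) l))))
                  (𝕏⊛-suc F m (j ℕ.+ suc l) (k ∸ l)) ⟩
      fromℕ ((j ℕ.+ suc l) C l ℕ.+ (j ℕ.+ suc l) C suc l) * F m (j ℕ.+ suc l) (k ∸ l)
        ≈⟨ *-congʳ (fromℕ-+ ((j ℕ.+ suc l) C l) ((j ℕ.+ suc l) C suc l)) ⟩
      (fromℕ ((j ℕ.+ suc l) C l) + fromℕ ((j ℕ.+ suc l) C suc l)) * F m (j ℕ.+ suc l) (k ∸ l)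
        ≈⟨ trans (distribʳ _ _ _) (+-comm _ _) ⟩
      termˡ (suc l) + termʳ (suc l) ∎
    shifted : ∀ l → termʳ (suc l) ≈ fromℕ ((suc j ℕ.+ l) C l) * F m (suc j ℕ.+ l) (k ∸ l)
    shifted l = reflexive (≡.cong (λ i → fromℕ (i C l) * F m i (k ∸ l)) (ℕₚ.+-suc j l))

  S-𝕏⊛ : ∀ F → S (𝕏 ⊛ F) ≐ ((𝕏 ⊕ 𝕐) ⊛ S F)
  S-𝕏⊛ F m j k = trans (shear j k) (sym (⊛-distribʳ 𝕏 𝕐 (S F) m j k))
    where
    shear : ∀ j k → S (𝕏 ⊛ F) m j k ≈ (𝕏 ⊛ S F) m j k + (𝕐 ⊛ S F) m j k
    shear zero zero = trans (trans (*-congˡ (𝕏⊛-zero F m 0)) (zeroʳ _))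
                            (sym (trans (+-cong (𝕏⊛-zero (S F) m 0) (𝕐⊛-zero (S F) m 0)) (+-identityʳ _)))
    shear zero (suc k) = begin
      S (𝕏 ⊛ F) m 0 (suc k)
        ≈⟨ Σ≤-suc-head k _ ⟩
      fromℕ 1 * (𝕏 ⊛ F) m 0 (suc k) + Σ≤ k (λ l → fromℕ (suc l C suc l) * (𝕏 ⊛ F) m (suc l) (k ∸ l))
        ≈⟨ +-cong (trans (*-congˡ (𝕏⊛-zero F m (suc k))) (zeroʳ _))
                  (Σ≤-cong′ k λ l → *-cong (reflexive (≡.cong fromℕ (≡.trans (nCn≡1 (suc l)) (≡.sym (nCn≡1 l)))))
                                           (𝕏⊛-suc F m l (k ∸ l))) ⟩
      0# + S F m 0 k
        ≈⟨ +-identityˡ _ ⟩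
      S F m 0 k
        ≈⟨ sym (trans (+-cong (𝕏⊛-zero (S F) m (suc k)) (𝕐⊛-suc (S F) m 0 k)) (+-identityˡ _)) ⟩
      (𝕏 ⊛ S F) m 0 (suc k) + (𝕐 ⊛ S F) m 0 (suc k) ∎
    shear (suc j) zero = begin
      fromℕ 1 * (𝕏 ⊛ F) m (suc j ℕ.+ 0) 0               ≈⟨ *-congˡ (𝕏⊛-suc F m (j ℕ.+ 0) 0) ⟩
      S F m j 0                                          ≈⟨ +-identityʳ _ ⟨
      S F m j 0 + 0#                                     ≈⟨ +-cong (𝕏⊛-suc (S F) m j 0) (𝕐⊛-zero (S F) m (suc j)) ⟨
      (𝕏 ⊛ S F) m (suc j) 0 + (𝕐 ⊛ S F) m (suc j) 0     ∎
    shear (suc j) (suc k) =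
      trans (S-𝕏⊛-suc-suc F m j k) (sym (+-cong (𝕏⊛-suc (S F) m j (suc k)) (𝕐⊛-suc (S F) m (suc j) k)))

  OnlyT : Ser → Set ℓ
  OnlyT Z = ∀ m a b → ¬ (a ≡ 0 × b ≡ 0) → Z m a b ≈ 0#

  OnlyT-⊛ : ∀ Z F → OnlyT Z → ∀ m a b → (Z ⊛ F) m a b ≈ Σ≤ m (λ m₁ → Z m₁ 0 0 * F (m ∸ m₁) a b)
  OnlyT-⊛ Z F onlyT m a b = Σ≤-cong′ m λ m₁ →
    trans (Σ≤-single a 0 z≤n λ a₁ _ a₁≢0 → Σ≤-zero b λ b₁ _ →
             trans (*-congʳ (onlyT m₁ a₁ b₁ (a₁≢0 ∘ proj₁))) (zeroˡ _))
          (Σ≤-single b 0 z≤n λ b₁ _ b₁≢0 → trans (*-congʳ (onlyT m₁ 0 b₁ (b₁≢0 ∘ proj₂))) (zeroˡ _))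

  S-OnlyT⊛ : ∀ Z F → OnlyT Z → S (Z ⊛ F) ≐ (Z ⊛ S F)
  S-OnlyT⊛ Z F onlyT m j k = begin
    S (Z ⊛ F) m j k
      ≈⟨ Σ≤-cong′ k (λ l → trans (*-congˡ (OnlyT-⊛ Z F onlyT m _ _)) (*-distribˡ-Σ≤ m _ _)) ⟩
    Σ≤ k (λ l → Σ≤ m (λ m₁ → fromℕ ((j ℕ.+ l) C l) * (Z m₁ 0 0 * F (m ∸ m₁) (j ℕ.+ l) (k ∸ l))))
      ≈⟨ Σ≤-comm k m _ ⟩
    Σ≤ m (λ m₁ → Σ≤ k (λ l → fromℕ ((j ℕ.+ l) C l) * (Z m₁ 0 0 * F (m ∸ m₁) (j ℕ.+ l) (k ∸ l))))
      ≈⟨ Σ≤-cong′ m (λ m₁ → trans (Σ≤-cong′ k λ _ → x∙yz≈y∙xz _ _ _) (sym (*-distribˡ-Σ≤ k _ _))) ⟩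
    Σ≤ m (λ m₁ → Z m₁ 0 0 * S F (m ∸ m₁) j k)
      ≈⟨ OnlyT-⊛ Z (S F) onlyT m j k ⟨
    (Z ⊛ S F) m j k ∎

  ⊛-OnlyT : ∀ Z₁ Z₂ → OnlyT Z₁ → OnlyT Z₂ → OnlyT (Z₁ ⊛ Z₂)
  ⊛-OnlyT Z₁ Z₂ onlyT₁ onlyT₂ m a b off =
    trans (OnlyT-⊛ Z₁ Z₂ onlyT₁ m a b) (Σ≤-zero m λ _ _ → trans (*-congˡ (onlyT₂ _ a b off)) (zeroʳ _))

  univ-OnlyT : ∀ q → OnlyT (univ q)
  univ-OnlyT q m zero    zero    off = ⊥-elim (off (≡.refl , ≡.refl))
  univ-OnlyT q m zero    (suc b) _   = refl
  univ-OnlyT q m (suc a) b       _   = refl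

  geom-OnlyT : ∀ u → OnlyT (geom u)
  geom-OnlyT u m zero    zero    off = ⊥-elim (off (≡.refl , ≡.refl))
  geom-OnlyT u m zero    (suc b) _   = refl
  geom-OnlyT u m (suc a) b       _   = refl

module ShearMultiplicativity {c ℓ} (R : CommutativeRing c ℓ) where
  open Poly R
  open Series R
  open Shear R
  open ≐-Reasoning

  -- Proving S (F ⊛ G) ≐ S F ⊛ S G in
  -- general would need Vandermonde's identity; instead the relation is checked on 𝕋, 𝕏, 𝕐
  -- and T-only series and shown to be closed under the series operations.
  _⇝_ : Ser → Ser → Set (c ⊔ ℓ)
  P ⇝ P′ = ∀ F → S (P ⊛ F) ≐ (P′ ⊛ S F)

  ⇝⇒S≐ : ∀ {P P′} → P ⇝ P′ → S P ≐ P′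
  ⇝⇒S≐ {P} {P′} P⇝P′ = begin
    S P          ≈⟨ S-cong (⊛-identityʳ P) ⟨
    S (P ⊛ 𝟙)    ≈⟨ P⇝P′ 𝟙 ⟩
    P′ ⊛ S 𝟙     ≈⟨ ⊛-congˡ S-𝟙 ⟩
    P′ ⊛ 𝟙       ≈⟨ ⊛-identityʳ P′ ⟩
    P′           ∎

  𝟙⇝𝟙 : 𝟙 ⇝ 𝟙
  𝟙⇝𝟙 F = 𝕊.trans (S-cong (⊛-identityˡ F)) (𝕊.sym (⊛-identityˡ (S F)))

  𝕏⇝𝕏⊕𝕐 : 𝕏 ⇝ (𝕏 ⊕ 𝕐)
  𝕏⇝𝕏⊕𝕐 = S-𝕏⊛

  𝕐⇝𝕐 : 𝕐 ⇝ 𝕐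
  𝕐⇝𝕐 = S-𝕐⊛

  𝕋⇝𝕋 : 𝕋 ⇝ 𝕋
  𝕋⇝𝕋 = S-𝕋⊛

  OnlyT⇒⇝ : ∀ Z → OnlyT Z → Z ⇝ Z
  OnlyT⇒⇝ Z onlyT F = S-OnlyT⊛ Z F onlyT

  ⇝-⊛ : ∀ {P P′ Q Q′} → P ⇝ P′ → Q ⇝ Q′ → (P ⊛ Q) ⇝ (P′ ⊛ Q′)
  ⇝-⊛ {P} {P′} {Q} {Q′} P⇝P′ Q⇝Q′ F = begin
    S ((P ⊛ Q) ⊛ F)      ≈⟨ S-cong (⊛-assoc P Q F) ⟩
    S (P ⊛ (Q ⊛ F))      ≈⟨ P⇝P′ (Q ⊛ F) ⟩
    P′ ⊛ S (Q ⊛ F)       ≈⟨ ⊛-congˡ (Q⇝Q′ F) ⟩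
    P′ ⊛ (Q′ ⊛ S F)      ≈⟨ ⊛-assoc P′ Q′ (S F) ⟨
    (P′ ⊛ Q′) ⊛ S F      ∎

  ⇝-⊕ : ∀ {P P′ Q Q′} → P ⇝ P′ → Q ⇝ Q′ → (P ⊕ Q) ⇝ (P′ ⊕ Q′)
  ⇝-⊕ {P} {P′} {Q} {Q′} P⇝P′ Q⇝Q′ F = begin
    S ((P ⊕ Q) ⊛ F)              ≈⟨ S-cong (⊛-distribʳ P Q F) ⟩
    S ((P ⊛ F) ⊕ (Q ⊛ F))        ≈⟨ S-⊕ (P ⊛ F) (Q ⊛ F) ⟩
    S (P ⊛ F) ⊕ S (Q ⊛ F)        ≈⟨ 𝕊.+-cong (P⇝P′ F) (Q⇝Q′ F) ⟩
    (P′ ⊛ S F) ⊕ (Q′ ⊛ S F)      ≈⟨ ⊛-distribʳ P′ Q′ (S F) ⟨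
    (P′ ⊕ Q′) ⊛ S F              ∎

  ⇝-· : ∀ u {P P′} → P ⇝ P′ → (u · P) ⇝ (u · P′)
  ⇝-· u {P} {P′} P⇝P′ F = begin
    S ((u · P) ⊛ F)      ≈⟨ S-cong (·-⊛ u P F) ⟩
    S (u · (P ⊛ F))      ≈⟨ S-· u (P ⊛ F) ⟩
    u · S (P ⊛ F)        ≈⟨ ·-cong u (P⇝P′ F) ⟩
    u · (P′ ⊛ S F)       ≈⟨ ·-⊛ u P′ (S F) ⟨
    (u · P′) ⊛ S F       ∎

  ⇝-⊝ : ∀ {P P′} → P ⇝ P′ → (⊝ P) ⇝ (⊝ P′)
  ⇝-⊝ {P} {P′} P⇝P′ F = begin
    S ((⊝ P) ⊛ F)        ≈⟨ S-cong (⊝-⊛ P F) ⟩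
    S (⊝ (P ⊛ F))        ≈⟨ S-⊝ (P ⊛ F) ⟩
    ⊝ S (P ⊛ F)          ≈⟨ 𝕊.-‿cong (P⇝P′ F) ⟩
    ⊝ (P′ ⊛ S F)         ≈⟨ ⊝-⊛ P′ (S F) ⟨
    (⊝ P′) ⊛ S F         ∎

  ⇝-^^ : ∀ {P P′} k → P ⇝ P′ → (P ^^ k) ⇝ (P′ ^^ k)
  ⇝-^^ zero    _     = 𝟙⇝𝟙
  ⇝-^^ (suc k) P⇝P′ = ⇝-⊛ P⇝P′ (⇝-^^ k P⇝P′)

  ⇝-Σs : ∀ n {P P′ : ℕ → Ser} → (∀ i → P i ⇝ P′ i) → Σs n P ⇝ Σs n P′
  ⇝-Σs zero    P⇝P′ = P⇝P′ 0
  ⇝-Σs (suc n) P⇝P′ = ⇝-⊕ (⇝-Σs n P⇝P′) (P⇝P′ (suc n))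

module ShearedCoefficients {c ℓ} (R : CommutativeRing c ℓ) where
  open CommutativeRing R hiding (zero)
  open Poly R
  open FiniteSums R
  open Series R
  open Monomials R
  open Numerals R
  open Shear R
  open ShearMultiplicativity R
  open SetoidReasoning setoid
  open import Algebra.Properties.CommutativeSemigroup *-commutativeSemigroup using (x∙yz≈y∙xz)

  module X+Y  = BinomialExpansion R 1# 0
  module X+2Y = BinomialExpansion R two 0

  -- shearCoeff n A j is the coefficient of xʲyⁿ⁻ʲ in W(x + y, y).
  shearCoeff : ℕ → (ℕ → Carrier) → ℕ → Carrier
  shearCoeff n A j = Σ≤ n (λ i → A i * fromℕ ((n ∸ i) C j))

  [𝕏⊕𝕐]^^-coeff : ∀ k j b → j ℕ.+ b ≡ k → ((𝕏 ⊕ 𝕐) ^^ k) 0 j b ≈ fromℕ (k C j)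
  [𝕏⊕𝕐]^^-coeff k j b jb = begin
    ((𝕏 ⊕ 𝕐) ^^ k) 0 j b      ≈⟨ ^^-cong k (λ _ _ _ → trans (+-comm _ _) (+-congʳ (sym (*-identityˡ _)))) 0 j b ⟩
    (X+Y.L ^^ k) 0 j b        ≈⟨ X+Y.L^^-coeff-at k 0 j b jb (≡.sym (ℕₚ.*-zeroʳ j)) ⟩
    fromℕ (k C j) * pw 1# b   ≈⟨ trans (*-congˡ (pw-1# b)) (*-identityʳ _) ⟩
    fromℕ (k C j)             ∎

  S-𝕏^^ : ∀ n j k → j ℕ.+ k ≡ n → S (𝕏 ^^ n) 0 j k ≈ fromℕ (n C j)
  S-𝕏^^ n j k jk = trans (⇝⇒S≐ (⇝-^^ n 𝕏⇝𝕏⊕𝕐) 0 j k) ([𝕏⊕𝕐]^^-coeff n j k jk)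

  [𝕏⊕𝕐]^^⊛𝕐^^-coeff : ∀ N i j k → j ℕ.+ k ≡ N → i ≤ N →
                      (((𝕏 ⊕ 𝕐) ^^ (N ∸ i)) ⊛ (𝕐 ^^ i)) 0 j k ≈ fromℕ ((N ∸ i) C j)
  [𝕏⊕𝕐]^^⊛𝕐^^-coeff N i j k jk i≤N with i ℕₚ.≤? k
  ... | yes i≤k = begin
    (((𝕏 ⊕ 𝕐) ^^ (N ∸ i)) ⊛ (𝕐 ^^ i)) 0 j k            ≈⟨ ⊛-comm ((𝕏 ⊕ 𝕐) ^^ (N ∸ i)) (𝕐 ^^ i) 0 j k ⟩
    ((𝕐 ^^ i) ⊛ ((𝕏 ⊕ 𝕐) ^^ (N ∸ i))) 0 j k            ≡⟨ ≡.cong (((𝕐 ^^ i) ⊛ ((𝕏 ⊕ 𝕐) ^^ (N ∸ i))) 0 j)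
                                                                (ℕₚ.m+[n∸m]≡n i≤k) ⟨
    ((𝕐 ^^ i) ⊛ ((𝕏 ⊕ 𝕐) ^^ (N ∸ i))) 0 j (i ℕ.+ (k ∸ i)) ≈⟨ 𝕐^^⊛-shift i ((𝕏 ⊕ 𝕐) ^^ (N ∸ i)) 0 j (k ∸ i) ⟩
    ((𝕏 ⊕ 𝕐) ^^ (N ∸ i)) 0 j (k ∸ i)                   ≈⟨ [𝕏⊕𝕐]^^-coeff (N ∸ i) j (k ∸ i)
                                                            (≡.trans (≡.sym (ℕₚ.+-∸-assoc j i≤k)) (≡.cong (_∸ i) jk)) ⟩
    fromℕ ((N ∸ i) C j)                                 ∎
  ... | no i≰k = begin
    (((𝕏 ⊕ 𝕐) ^^ (N ∸ i)) ⊛ (𝕐 ^^ i)) 0 j k   ≈⟨ ⊛-comm ((𝕏 ⊕ 𝕐) ^^ (N ∸ i)) (𝕐 ^^ i) 0 j k ⟩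
    ((𝕐 ^^ i) ⊛ ((𝕏 ⊕ 𝕐) ^^ (N ∸ i))) 0 j k   ≈⟨ 𝕐^^⊛-below i ((𝕏 ⊕ 𝕐) ^^ (N ∸ i)) 0 j k (ℕₚ.≰⇒> i≰k) ⟩
    0#                                         ≡⟨ ≡.cong fromℕ (k>n⇒nCk≡0 N∸i<j) ⟨
    fromℕ ((N ∸ i) C j)                        ∎
    where
    N∸i<j : N ∸ i < j
    N∸i<j = ≡.subst (λ x → x ∸ i < j) jk
              (k<i⇒[j+k]∸i<j j k i (ℕₚ.≰⇒> i≰k) (≡.subst (i ≤_) (≡.sym jk) i≤N))

  S-hom : ∀ n A j k → j ℕ.+ k ≡ n → S (hom n A) 0 j k ≈ shearCoeff n A j
  S-hom n A j k jk = begin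
    S (hom n A) 0 j k
      ≈⟨ ⇝⇒S≐ hom⇝ 0 j k ⟩
    Σs n (λ i → A i · (((𝕏 ⊕ 𝕐) ^^ (n ∸ i)) ⊛ (𝕐 ^^ i))) 0 j k
      ≈⟨ Σs-pointwise n _ 0 j k ⟩
    Σ≤ n (λ i → A i * (((𝕏 ⊕ 𝕐) ^^ (n ∸ i)) ⊛ (𝕐 ^^ i)) 0 j k)
      ≈⟨ Σ≤-cong n (λ i i≤n → *-congˡ ([𝕏⊕𝕐]^^⊛𝕐^^-coeff n i j k jk i≤n)) ⟩
    shearCoeff n A j ∎
    where
    hom⇝ = ⇝-Σs n λ i → ⇝-· (A i) (⇝-⊛ (⇝-^^ (n ∸ i) 𝕏⇝𝕏⊕𝕐) (⇝-^^ i 𝕐⇝𝕐))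

  [𝕏⊕2𝕐]^^⊛𝕏^^-coeff : ∀ N i j k → j ℕ.+ k ≡ N → i ≤ N →
                       ((X+2Y.L ^^ (N ∸ i)) ⊛ (𝕏 ^^ i)) 0 j k ≈ fromℕ ((N ∸ i) C k) * pw two k
  [𝕏⊕2𝕐]^^⊛𝕏^^-coeff N i j k jk i≤N with i ℕₚ.≤? j
  ... | yes i≤j = begin
    ((X+2Y.L ^^ (N ∸ i)) ⊛ (𝕏 ^^ i)) 0 j k                ≈⟨ ⊛-comm (X+2Y.L ^^ (N ∸ i)) (𝕏 ^^ i) 0 j k ⟩
    ((𝕏 ^^ i) ⊛ (X+2Y.L ^^ (N ∸ i))) 0 j k                ≡⟨ ≡.cong (λ a → ((𝕏 ^^ i) ⊛ (X+2Y.L ^^ (N ∸ i))) 0 a k)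
                                                                   (ℕₚ.m+[n∸m]≡n i≤j) ⟨
    ((𝕏 ^^ i) ⊛ (X+2Y.L ^^ (N ∸ i))) 0 (i ℕ.+ (j ∸ i)) k  ≈⟨ 𝕏^^⊛-shift i (X+2Y.L ^^ (N ∸ i)) 0 (j ∸ i) k ⟩
    (X+2Y.L ^^ (N ∸ i)) 0 (j ∸ i) k                       ≈⟨ X+2Y.L^^-coeff-at (N ∸ i) 0 (j ∸ i) k [j∸i]+k≡N∸i
                                                               (≡.sym (ℕₚ.*-zeroʳ (j ∸ i))) ⟩
    fromℕ ((N ∸ i) C (j ∸ i)) * pw two k                  ≡⟨ ≡.cong (λ x → fromℕ x * pw two k) symmetric ⟩
    fromℕ ((N ∸ i) C k) * pw two k                        ∎
    where
    [j∸i]+k≡N∸i : (j ∸ i) ℕ.+ k ≡ N ∸ i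
    [j∸i]+k≡N∸i = ≡.trans (≡.sym (ℕₚ.+-∸-comm k i≤j)) (≡.cong (_∸ i) jk)
    symmetric : (N ∸ i) C (j ∸ i) ≡ (N ∸ i) C k
    symmetric = ≡.subst (λ x → x C (j ∸ i) ≡ x C k) [j∸i]+k≡N∸i ([a+b]Ca≡[a+b]Cb (j ∸ i) k)
  ... | no i≰j = begin
    ((X+2Y.L ^^ (N ∸ i)) ⊛ (𝕏 ^^ i)) 0 j k   ≈⟨ ⊛-comm (X+2Y.L ^^ (N ∸ i)) (𝕏 ^^ i) 0 j k ⟩
    ((𝕏 ^^ i) ⊛ (X+2Y.L ^^ (N ∸ i))) 0 j k   ≈⟨ 𝕏^^⊛-below i (X+2Y.L ^^ (N ∸ i)) 0 j k (ℕₚ.≰⇒> i≰j) ⟩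
    0#                                       ≈⟨ zeroˡ _ ⟨
    0# * pw two k                            ≡⟨ ≡.cong (λ x → fromℕ x * pw two k) (k>n⇒nCk≡0 N∸i<k) ⟨
    fromℕ ((N ∸ i) C k) * pw two k           ∎
    where
    k+j≡N : k ℕ.+ j ≡ N
    k+j≡N = ≡.trans (ℕₚ.+-comm k j) jk
    N∸i<k : N ∸ i < k
    N∸i<k = ≡.subst (λ x → x ∸ i < k) k+j≡N
              (k<i⇒[j+k]∸i<j k j i (ℕₚ.≰⇒> i≰j) (≡.subst (i ≤_) (≡.sym k+j≡N) i≤N))

  sheared-substTerm-coeff : ∀ r N i j k → j ℕ.+ k ≡ N → i ≤ N →
    (((r · ((𝕏 ⊕ 𝕐) ⊕ 𝕐)) ^^ (N ∸ i)) ⊛ ((r · ((𝕏 ⊕ 𝕐) ⊕ (⊝ 𝕐))) ^^ i)) 0 j k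
      ≈ pw r N * (pw two k * fromℕ ((N ∸ i) C k))
  sheared-substTerm-coeff r N i j k jk i≤N = begin
    (((r · V₁) ^^ (N ∸ i)) ⊛ ((r · V₂) ^^ i)) 0 j k
      ≈⟨ ⊛-cong (𝕊.trans (·-^^ r V₁ (N ∸ i)) (·-cong (pw r (N ∸ i)) (^^-cong (N ∸ i) V₁≐X+2Y)))
                (𝕊.trans (·-^^ r V₂ i) (·-cong (pw r i) (^^-cong i V₂≐𝕏))) 0 j k ⟩
    ((pw r (N ∸ i) · (X+2Y.L ^^ (N ∸ i))) ⊛ (pw r i · (𝕏 ^^ i))) 0 j k
      ≈⟨ trans (·-⊛ (pw r (N ∸ i)) (X+2Y.L ^^ (N ∸ i)) (pw r i · (𝕏 ^^ i)) 0 j k) (*-congˡ (⊛-· (pw r i) (X+2Y.L ^^ (N ∸ i)) (𝕏 ^^ i) 0 j k)) ⟩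
    pw r (N ∸ i) * (pw r i * ((X+2Y.L ^^ (N ∸ i)) ⊛ (𝕏 ^^ i)) 0 j k)
      ≈⟨ sym (*-assoc _ _ _) ⟩
    (pw r (N ∸ i) * pw r i) * ((X+2Y.L ^^ (N ∸ i)) ⊛ (𝕏 ^^ i)) 0 j k
      ≈⟨ *-cong (trans (sym (pw-+ r (N ∸ i) i)) (reflexive (≡.cong (pw r) (ℕₚ.m∸n+n≡m i≤N))))
                ([𝕏⊕2𝕐]^^⊛𝕏^^-coeff N i j k jk i≤N) ⟩
    pw r N * (fromℕ ((N ∸ i) C k) * pw two k)
      ≈⟨ *-congˡ (*-comm _ _) ⟩
    pw r N * (pw two k * fromℕ ((N ∸ i) C k)) ∎
    where
    V₁ V₂ : Ser
    V₁ = (𝕏 ⊕ 𝕐) ⊕ 𝕐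
    V₂ = (𝕏 ⊕ 𝕐) ⊕ (⊝ 𝕐)
    V₁≐X+2Y : V₁ ≐ X+2Y.L
    V₁≐X+2Y m a b = begin
      (𝕏 m a b + 𝕐 m a b) + 𝕐 m a b    ≈⟨ trans (+-assoc _ _ _) (+-comm _ _) ⟩
      (𝕐 m a b + 𝕐 m a b) + 𝕏 m a b    ≈⟨ +-congʳ (sym (trans (distribʳ _ _ _) (+-cong (*-identityˡ _) (*-identityˡ _)))) ⟩
      two * 𝕐 m a b + 𝕏 m a b          ∎
    V₂≐𝕏 : V₂ ≐ 𝕏
    V₂≐𝕏 m a b = trans (+-assoc _ _ _) (trans (+-congˡ (-‿inverseʳ _)) (+-identityʳ _))

  S-subst√2 : ∀ r n A j k → j ℕ.+ k ≡ n → S (subst√2 r n A) 0 j k ≈ pw r n * (pw two k * shearCoeff n A k)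
  S-subst√2 r n A j k jk = begin
    S (subst√2 r n A) 0 j k
      ≈⟨ ⇝⇒S≐ subst⇝ 0 j k ⟩
    Σs n (λ i → A i · (((r · ((𝕏 ⊕ 𝕐) ⊕ 𝕐)) ^^ (n ∸ i)) ⊛ ((r · ((𝕏 ⊕ 𝕐) ⊕ (⊝ 𝕐))) ^^ i))) 0 j k
      ≈⟨ Σs-pointwise n _ 0 j k ⟩
    Σ≤ n (λ i → A i * (((r · ((𝕏 ⊕ 𝕐) ⊕ 𝕐)) ^^ (n ∸ i)) ⊛ ((r · ((𝕏 ⊕ 𝕐) ⊕ (⊝ 𝕐))) ^^ i)) 0 j k)
      ≈⟨ Σ≤-cong n (λ i i≤n → *-congˡ (sheared-substTerm-coeff r n i j k jk i≤n)) ⟩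
    Σ≤ n (λ i → A i * (pw r n * (pw two k * fromℕ ((n ∸ i) C k))))
      ≈⟨ Σ≤-cong′ n (λ i → trans (x∙yz≈y∙xz _ _ _) (*-congˡ (x∙yz≈y∙xz _ _ _))) ⟩
    Σ≤ n (λ i → pw r n * (pw two k * (A i * fromℕ ((n ∸ i) C k))))
      ≈⟨ trans (*-congˡ (*-distribˡ-Σ≤ n (pw two k) _)) (*-distribˡ-Σ≤ n (pw r n) _) ⟨
    pw r n * (pw two k * shearCoeff n A k) ∎
    where
    subst⇝ = ⇝-Σs n λ i → ⇝-· (A i) (⇝-⊛ (⇝-^^ (n ∸ i) (⇝-· r (⇝-⊕ 𝕏⇝𝕏⊕𝕐 𝕐⇝𝕐)))
                                         (⇝-^^ i (⇝-· r (⇝-⊕ 𝕏⇝𝕏⊕𝕐 (⇝-⊝ 𝕐⇝𝕐)))))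

module GeometricSeries {c ℓ} (R : CommutativeRing c ℓ) where
  open CommutativeRing R hiding (zero)
  open Poly R
  open Series R
  open Monomials R
  open import Algebra.Properties.Ring ring using (-0#≈0#)

  1-u𝕋 : Carrier → Ser
  1-u𝕋 u = 𝟙 ⊕ (⊝ (u · 𝕋))

  1-u𝕋⊛ : ∀ u F m a b → (1-u𝕋 u ⊛ F) m a b ≈ F m a b + - (u * (𝕋 ⊛ F) m a b)
  1-u𝕋⊛ u F m a b = begin
    (1-u𝕋 u ⊛ F) m a b                        ≈⟨ ⊛-distribʳ 𝟙 (⊝ (u · 𝕋)) F m a b ⟩
    (𝟙 ⊛ F) m a b + ((⊝ (u · 𝕋)) ⊛ F) m a b   ≈⟨ +-cong (⊛-identityˡ F m a b)
                                                        (trans (⊝-⊛ (u · 𝕋) F m a b) (-‿cong (·-⊛ u 𝕋 F m a b))) ⟩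
    F m a b + - (u * (𝕋 ⊛ F) m a b)           ∎
    where open SetoidReasoning setoid

  1-u𝕋⊛geom : ∀ u → (1-u𝕋 u ⊛ geom u) ≐ 𝟙
  1-u𝕋⊛geom u m a b = trans (1-u𝕋⊛ u (geom u) m a b) (telescope m a b)
    where
    -u*0≈0 : - (u * 0#) ≈ 0#
    -u*0≈0 = trans (-‿cong (zeroʳ u)) -0#≈0#
    telescope : ∀ m a b → geom u m a b + - (u * (𝕋 ⊛ geom u) m a b) ≈ 𝟙 m a b
    telescope zero    a       b       = trans (+-congˡ (trans (-‿cong (*-congˡ (𝕋⊛-zero (geom u) a b))) -u*0≈0))
                                              (trans (+-identityʳ _) (constant a b))
      where
      constant : ∀ a b → geom u 0 a b ≈ 𝟙 0 a b
      constant zero    zero    = refl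
      constant zero    (suc b) = refl
      constant (suc a) b       = refl
    telescope (suc m) zero    zero    = trans (+-congˡ (-‿cong (*-congˡ (𝕋⊛-suc (geom u) m 0 0)))) (-‿inverseʳ _)
    telescope (suc m) zero    (suc b) = trans (+-congˡ (trans (-‿cong (*-congˡ (𝕋⊛-suc (geom u) m 0 (suc b)))) -u*0≈0))
                                              (+-identityʳ _)
    telescope (suc m) (suc a) b       = trans (+-congˡ (trans (-‿cong (*-congˡ (𝕋⊛-suc (geom u) m (suc a) b))) -u*0≈0))
                                              (+-identityʳ _)

  1-u𝕋⊛[F⊛geom] : ∀ u F → (1-u𝕋 u ⊛ (F ⊛ geom u)) ≐ F
  1-u𝕋⊛[F⊛geom] u F = begin
    1-u𝕋 u ⊛ (F ⊛ geom u)     ≈⟨ ⊛-congˡ (⊛-comm F (geom u)) ⟩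
    1-u𝕋 u ⊛ (geom u ⊛ F)     ≈⟨ ⊛-assoc (1-u𝕋 u) (geom u) F ⟨
    (1-u𝕋 u ⊛ geom u) ⊛ F     ≈⟨ ⊛-congʳ {G = F} (1-u𝕋⊛geom u) ⟩
    𝟙 ⊛ F                     ≈⟨ ⊛-identityˡ F ⟩
    F                         ∎
    where open ≐-Reasoning

module SecondDifference {c ℓ} (R : CommutativeRing c ℓ) where
  open CommutativeRing R hiding (zero)
  open Poly R using (two)
  open SetoidReasoning setoid
  open import Algebra.Properties.Ring ring using (-‿distribʳ-*; -‿+-comm; x[y-z]≈xy-xz; ⁻¹-anti-homo‿-)
  open import Algebra.Properties.CommutativeSemigroup *-commutativeSemigroup using (x∙yz≈y∙xz)
  open import Algebra.Properties.CommutativeSemigroup +-commutativeSemigroup using (interchange)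

  Δ² : Carrier → Carrier → Carrier → Carrier
  Δ² a₂ a₁ a₀ = (a₂ - a₁) - two * (a₁ - a₀)

  Δ²-cong : ∀ {a₂ a₁ a₀ b₂ b₁ b₀} → a₂ ≈ b₂ → a₁ ≈ b₁ → a₀ ≈ b₀ → Δ² a₂ a₁ a₀ ≈ Δ² b₂ b₁ b₀
  Δ²-cong a₂≈b₂ a₁≈b₁ a₀≈b₀ =
    +-cong (+-cong a₂≈b₂ (-‿cong a₁≈b₁)) (-‿cong (*-congˡ (+-cong a₁≈b₁ (-‿cong a₀≈b₀))))

  *-distribˡ-Δ² : ∀ u a₂ a₁ a₀ → u * Δ² a₂ a₁ a₀ ≈ Δ² (u * a₂) (u * a₁) (u * a₀)
  *-distribˡ-Δ² u a₂ a₁ a₀ = begin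
    u * ((a₂ - a₁) - two * (a₁ - a₀))            ≈⟨ x[y-z]≈xy-xz u _ _ ⟩
    u * (a₂ - a₁) - u * (two * (a₁ - a₀))        ≈⟨ +-cong (x[y-z]≈xy-xz u a₂ a₁) (-‿cong (x∙yz≈y∙xz u two _)) ⟩
    (u * a₂ - u * a₁) - two * (u * (a₁ - a₀))    ≈⟨ +-congˡ (-‿cong (*-congˡ (x[y-z]≈xy-xz u a₁ a₀))) ⟩
    (u * a₂ - u * a₁) - two * (u * a₁ - u * a₀)  ∎

  Δ²-neg : ∀ a₂ a₁ a₀ → Δ² (- a₂) (- a₁) (- a₀) ≈ - Δ² a₂ a₁ a₀
  Δ²-neg a₂ a₁ a₀ = begin
    (- a₂ - - a₁) - two * (- a₁ - - a₀)   ≈⟨ +-cong (-‿+-comm a₂ (- a₁)) (-‿cong (*-congˡ (-‿+-comm a₁ (- a₀)))) ⟩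
    - (a₂ - a₁) - two * - (a₁ - a₀)       ≈⟨ +-congˡ (-‿cong (-‿distribʳ-* two _)) ⟨
    - (a₂ - a₁) - - (two * (a₁ - a₀))     ≈⟨ -‿+-comm (a₂ - a₁) (- (two * (a₁ - a₀))) ⟩
    - Δ² a₂ a₁ a₀                         ∎

  Δ²-expand : ∀ w y x → Δ² (two * w) y x ≈ (two * w + two * x) - (y + two * y)
  Δ²-expand w y x = begin
    (two * w - y) - two * (y - x)         ≈⟨ +-congˡ (trans (-‿cong (x[y-z]≈xy-xz two y x)) (⁻¹-anti-homo‿- _ _)) ⟩
    (two * w - y) + (two * x - two * y)   ≈⟨ interchange _ _ _ _ ⟩
    (two * w + two * x) + (- y - two * y) ≈⟨ +-congˡ (-‿+-comm y (two * y)) ⟩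
    (two * w + two * x) - (y + two * y)   ∎

  Δ²-swap : ∀ w y x → Δ² (two * w) y x ≈ Δ² (two * x) y w
  Δ²-swap w y x = trans (Δ²-expand w y x) (trans (+-congʳ (+-comm _ _)) (sym (Δ²-expand x y w)))

  [x+e]-[y+e]≈x-y : ∀ e x y → (x + e) - (y + e) ≈ x - y
  [x+e]-[y+e]≈x-y e x y = begin
    (x + e) - (y + e)      ≈⟨ +-congˡ (-‿+-comm y e) ⟨
    (x + e) + (- y - e)    ≈⟨ interchange _ _ _ _ ⟩
    (x - y) + (e - e)      ≈⟨ +-congˡ (-‿inverseʳ e) ⟩
    (x - y) + 0#           ≈⟨ +-identityʳ _ ⟩
    x - y                  ∎

  Δ²-shift : ∀ e a₂ a₁ a₀ → Δ² (a₂ + e) (a₁ + e) (a₀ + e) ≈ Δ² a₂ a₁ a₀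
  Δ²-shift e a₂ a₁ a₀ = +-cong ([x+e]-[y+e]≈x-y e a₂ a₁) (-‿cong (*-congˡ ([x+e]-[y+e]≈x-y e a₁ a₀)))

  Δ²-const : ∀ x → Δ² x x x ≈ 0#
  Δ²-const x = begin
    (x - x) - two * (x - x)   ≈⟨ +-cong (-‿inverseʳ x) (-‿cong (trans (*-congˡ (-‿inverseʳ x)) (zeroʳ two))) ⟩
    0# - 0#                   ≈⟨ -‿inverseʳ 0# ⟩
    0#                        ∎

module ZetaCoefficients {c ℓ} (R : CommutativeRing c ℓ) (n d : ℕ) (p : ℕ → CommutativeRing.Carrier R) where
  open CommutativeRing R hiding (zero)
  open Poly R
  open FiniteSums R
  open Series R
  open Monomials R
  open Numerals R
  open Shear R
  open ShearMultiplicativity R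
  open ShearedCoefficients R
  open GeometricSeries R
  open SecondDifference R using (Δ²)
  open import Algebra.Properties.Ring ring using (-0#≈0#)

  module Y+TX = BinomialExpansion R 1# 1

  M : ℕ
  M = n ∸ d

  Z : Ser
  Z = (univ p ⊛ geom 1#) ⊛ geom two

  Z-OnlyT : OnlyT Z
  Z-OnlyT = ⊛-OnlyT _ _ (⊛-OnlyT _ _ (univ-OnlyT p) (geom-OnlyT 1#)) (geom-OnlyT two)

  -- ζ (m + 2) is the coefficient of Tᵐ in P(T)/((1-T)(1-2T)).  The shift by two makes
  -- ζ (M + 2 ∸ j) vanish exactly for j > M, with truncated subtraction doing the work.
  ζ : ℕ → Carrier
  ζ zero          = 0#
  ζ (suc zero)    = 0#
  ζ (suc (suc m)) = Z m 0 0

  ζ≤1 : ∀ x → x ≤ 1 → ζ x ≈ 0#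
  ζ≤1 zero          _        = refl
  ζ≤1 (suc zero)    _        = refl
  ζ≤1 (suc (suc x)) (s≤s ())

  Z⊛[𝕐+𝕋𝕏]^^n-coeff : ∀ j k → j ℕ.+ k ≡ n → (Z ⊛ (Y+TX.L ^^ n)) M j k ≈ ζ (suc (suc M) ∸ j) * fromℕ (n C j)
  Z⊛[𝕐+𝕋𝕏]^^n-coeff j k jk with j ℕₚ.≤? M
  ... | yes j≤M = begin
    (Z ⊛ (Y+TX.L ^^ n)) M j k
      ≈⟨ OnlyT-⊛ Z (Y+TX.L ^^ n) Z-OnlyT M j k ⟩
    Σ≤ M (λ m₁ → Z m₁ 0 0 * (Y+TX.L ^^ n) (M ∸ m₁) j k)
      ≈⟨ Σ≤-single M (M ∸ j) (ℕₚ.m∸n≤m M j) (λ m₁ m₁≤M m₁≢M∸j →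
           trans (*-congˡ (Y+TX.L^^-off n _ j k λ (_ , M∸m₁≡j*1) →
                   m₁≢M∸j (≡.trans (≡.sym (ℕₚ.m∸[m∸n]≡n m₁≤M)) (≡.cong (M ∸_) (≡.trans M∸m₁≡j*1 (ℕₚ.*-identityʳ j))))))
                 (zeroʳ _)) ⟩
    Z (M ∸ j) 0 0 * (Y+TX.L ^^ n) (M ∸ (M ∸ j)) j k
      ≈⟨ *-cong (reflexive (≡.cong ζ (≡.sym M+2∸j≡2+[M∸j])))
                (Y+TX.L^^-coeff-at n _ j k jk (≡.trans (ℕₚ.m∸[m∸n]≡n j≤M) (≡.sym (ℕₚ.*-identityʳ j)))) ⟩
    ζ (suc (suc M) ∸ j) * (fromℕ (n C j) * pw 1# k)
      ≈⟨ *-congˡ (trans (*-congˡ (pw-1# k)) (*-identityʳ _)) ⟩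
    ζ (suc (suc M) ∸ j) * fromℕ (n C j) ∎
    where
    open SetoidReasoning setoid
    M+2∸j≡2+[M∸j] : suc (suc M) ∸ j ≡ suc (suc (M ∸ j))
    M+2∸j≡2+[M∸j] = ≡.trans (≡.cong (_∸ j) (ℕₚ.+-comm 2 M)) (≡.trans (ℕₚ.+-∸-comm 2 j≤M) (ℕₚ.+-comm (M ∸ j) 2))
  ... | no j≰M = begin
    (Z ⊛ (Y+TX.L ^^ n)) M j k
      ≈⟨ OnlyT-⊛ Z (Y+TX.L ^^ n) Z-OnlyT M j k ⟩
    Σ≤ M (λ m₁ → Z m₁ 0 0 * (Y+TX.L ^^ n) (M ∸ m₁) j k)
      ≈⟨ Σ≤-zero M (λ m₁ _ → trans (*-congˡ (Y+TX.L^^-off n _ j k λ (_ , M∸m₁≡j*1) →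
           j≰M (≡.subst (_≤ M) (≡.trans M∸m₁≡j*1 (ℕₚ.*-identityʳ j)) (ℕₚ.m∸n≤m M m₁)))) (zeroʳ _)) ⟩
    0#
      ≈⟨ trans (*-congʳ (ζ≤1 _ M+2∸j≤1)) (zeroˡ _) ⟨
    ζ (suc (suc M) ∸ j) * fromℕ (n C j) ∎
    where
    open SetoidReasoning setoid
    M+2∸j≤1 : suc (suc M) ∸ j ≤ 1
    M+2∸j≤1 = ℕₚ.m≤n+o⇒m∸n≤o (suc (suc M)) j (≡.subst (suc (suc M) ≤_) (ℕₚ.+-comm 1 j) (s≤s (ℕₚ.≰⇒> j≰M)))

  S-zetaSide : S ((univ p ⊛ geom 1#) ⊛ (geom two ⊛ (((𝕐 ⊕ (⊝ (𝕋 ⊛ 𝕐))) ⊕ (𝕋 ⊛ 𝕏)) ^^ n)))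
               ≐ (Z ⊛ (Y+TX.L ^^ n))
  S-zetaSide = begin
    S ((univ p ⊛ geom 1#) ⊛ (geom two ⊛ (L ^^ n)))  ≈⟨ S-cong (⊛-assoc (univ p ⊛ geom 1#) (geom two) (L ^^ n)) ⟨
    S (Z ⊛ (L ^^ n))                                ≈⟨ OnlyT⇒⇝ Z Z-OnlyT (L ^^ n) ⟩
    Z ⊛ S (L ^^ n)                                  ≈⟨ ⊛-congˡ (⇝⇒S≐ (⇝-^^ n L⇝)) ⟩
    Z ⊛ (L′ ^^ n)                                   ≈⟨ ⊛-congˡ (^^-cong n L′≐Y+TX) ⟩
    Z ⊛ (Y+TX.L ^^ n)                               ∎
    where
    open ≐-Reasoning
    L L′ : Ser
    L  = (𝕐 ⊕ (⊝ (𝕋 ⊛ 𝕐))) ⊕ (𝕋 ⊛ 𝕏)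
    L′ = (𝕐 ⊕ (⊝ (𝕋 ⊛ 𝕐))) ⊕ (𝕋 ⊛ (𝕏 ⊕ 𝕐))
    L⇝ : L ⇝ L′
    L⇝ = ⇝-⊕ (⇝-⊕ 𝕐⇝𝕐 (⇝-⊝ (⇝-⊛ 𝕋⇝𝕋 𝕐⇝𝕐))) (⇝-⊛ 𝕋⇝𝕋 𝕏⇝𝕏⊕𝕐)
    L′≐Y+TX : L′ ≐ Y+TX.L
    L′≐Y+TX m a b = trans (+-congˡ (⊛-distribˡ 𝕏 𝕐 𝕋 m a b)) (trans cancel (+-cong (sym (*-identityˡ _)) (𝕋𝕏≐ m a b)))
      where
      open import Algebra.Properties.CommutativeSemigroup +-commutativeSemigroup using (interchange)
      y = 𝕐 m a b ; ty = (𝕋 ⊛ 𝕐) m a b ; tx = (𝕋 ⊛ 𝕏) m a b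
      cancel : (y + - ty) + (tx + ty) ≈ y + tx
      cancel = trans (interchange _ _ _ _) (trans (+-congˡ (-‿inverseˡ ty)) (+-identityʳ _))
      𝕋𝕏≐ : (𝕋 ⊛ 𝕏) ≐ mono 1# 1 1 0
      𝕋𝕏≐ zero    a b = 𝕋⊛-zero 𝕏 a b
      𝕋𝕏≐ (suc m) a b = 𝕋⊛-suc 𝕏 m a b

  zeta-sheared : ∀ A → IsZetaPoly n d A p → ∀ j k → j ℕ.+ k ≡ n →
                 ζ (suc (suc M) ∸ j) * fromℕ (n C j) ≈ shearCoeff n A j + - fromℕ (n C j)
  zeta-sheared A zp j k jk = begin
    ζ (suc (suc M) ∸ j) * fromℕ (n C j)          ≈⟨ Z⊛[𝕐+𝕋𝕏]^^n-coeff j k jk ⟨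
    (Z ⊛ (Y+TX.L ^^ n)) M j k                    ≈⟨ S-zetaSide M j k ⟨
    S zetaSide M j k                             ≈⟨ S-layer-cong zetaSide (hom n A ⊕ (⊝ (𝕏 ^^ n))) M 0 (proj₂ zp) j k ⟩
    S (hom n A ⊕ (⊝ (𝕏 ^^ n))) 0 j k             ≈⟨ S-⊕ (hom n A) (⊝ (𝕏 ^^ n)) 0 j k ⟩
    S (hom n A) 0 j k + S (⊝ (𝕏 ^^ n)) 0 j k     ≈⟨ +-cong (S-hom n A j k jk)
                                                          (trans (S-⊝ (𝕏 ^^ n) 0 j k) (-‿cong (S-𝕏^^ n j k jk))) ⟩
    shearCoeff n A j + - fromℕ (n C j)           ∎
    where
    open SetoidReasoning setoid
    zetaSide : Ser
    zetaSide = (univ p ⊛ geom 1#) ⊛ (geom two ⊛ (((𝕐 ⊕ (⊝ (𝕋 ⊛ 𝕐))) ⊕ (𝕋 ⊛ 𝕏)) ^^ n))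

  [1-𝕋]⊛Z-coeff : ∀ m → (1-u𝕋 1# ⊛ Z) m 0 0 ≈ ζ (suc (suc m)) - ζ (suc m)
  [1-𝕋]⊛Z-coeff zero    = trans (1-u𝕋⊛ 1# Z 0 0 0) (+-congˡ (-‿cong (trans (*-congˡ (𝕋⊛-zero Z 0 0)) (zeroʳ _))))
  [1-𝕋]⊛Z-coeff (suc m) = trans (1-u𝕋⊛ 1# Z (suc m) 0 0) (+-congˡ (-‿cong (trans (*-identityˡ _) (𝕋⊛-suc Z m 0 0))))

  𝕋⊛[1-𝕋]⊛Z-coeff : ∀ m → (𝕋 ⊛ (1-u𝕋 1# ⊛ Z)) m 0 0 ≈ ζ (suc m) - ζ m
  𝕋⊛[1-𝕋]⊛Z-coeff zero    = trans (𝕋⊛-zero (1-u𝕋 1# ⊛ Z) 0 0) (sym (trans (+-congˡ -0#≈0#) (+-identityʳ _)))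
  𝕋⊛[1-𝕋]⊛Z-coeff (suc m) = trans (𝕋⊛-suc (1-u𝕋 1# ⊛ Z) m 0 0) ([1-𝕋]⊛Z-coeff m)

  [1-2𝕋][1-𝕋]Z≐P : (1-u𝕋 two ⊛ (1-u𝕋 1# ⊛ Z)) ≐ univ p
  [1-2𝕋][1-𝕋]Z≐P = begin
    1-u𝕋 two ⊛ (1-u𝕋 1# ⊛ ((univ p ⊛ geom 1#) ⊛ geom two))
      ≈⟨ ⊛-congˡ (⊛-assoc (1-u𝕋 1#) (univ p ⊛ geom 1#) (geom two)) ⟨
    1-u𝕋 two ⊛ ((1-u𝕋 1# ⊛ (univ p ⊛ geom 1#)) ⊛ geom two)
      ≈⟨ ⊛-congˡ (⊛-congʳ {G = geom two} (1-u𝕋⊛[F⊛geom] 1# (univ p))) ⟩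
    1-u𝕋 two ⊛ (univ p ⊛ geom two)
      ≈⟨ 1-u𝕋⊛[F⊛geom] two (univ p) ⟩
    univ p ∎
    where open ≐-Reasoning

  p≈Δ²ζ : ∀ m → p m ≈ Δ² (ζ (suc (suc m))) (ζ (suc m)) (ζ m)
  p≈Δ²ζ m = begin
    p m                                                         ≈⟨ [1-2𝕋][1-𝕋]Z≐P m 0 0 ⟨
    (1-u𝕋 two ⊛ (1-u𝕋 1# ⊛ Z)) m 0 0                            ≈⟨ 1-u𝕋⊛ two (1-u𝕋 1# ⊛ Z) m 0 0 ⟩
    (1-u𝕋 1# ⊛ Z) m 0 0 + - (two * (𝕋 ⊛ (1-u𝕋 1# ⊛ Z)) m 0 0)   ≈⟨ +-cong ([1-𝕋]⊛Z-coeff m)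
                                                                         (-‿cong (*-congˡ (𝕋⊛[1-𝕋]⊛Z-coeff m))) ⟩
    Δ² (ζ (suc (suc m))) (ζ (suc m)) (ζ m)                      ∎
    where open SetoidReasoning setoid

module CharZeroField {c ℓ} (R : CommutativeRing c ℓ) (isField : Poly.IsFieldChar0 R) where
  open CommutativeRing R hiding (zero)
  open Poly R
  open Numerals R
  open SetoidReasoning setoid

  *-cancelˡ : ∀ {u x y} → ¬ u ≈ 0# → u * x ≈ u * y → x ≈ y
  *-cancelˡ {u} {x} {y} u≉0 ux≈uy with proj₁ (proj₂ isField) u u≉0
  ... | v , uv≈1 = begin
    x              ≈⟨ *-identityˡ x ⟨
    1# * x         ≈⟨ *-congʳ (trans (*-comm v u) uv≈1) ⟨
    (v * u) * x    ≈⟨ *-assoc v u x ⟩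
    v * (u * x)    ≈⟨ *-congˡ ux≈uy ⟩
    v * (u * y)    ≈⟨ *-assoc v u y ⟨
    (v * u) * y    ≈⟨ *-congʳ (trans (*-comm v u) uv≈1) ⟩
    1# * y         ≈⟨ *-identityˡ y ⟩
    y              ∎

  u*x≈0⇒x≈0 : ∀ {u x} → ¬ u ≈ 0# → u * x ≈ 0# → x ≈ 0#
  u*x≈0⇒x≈0 u≉0 ux≈0 = *-cancelˡ u≉0 (trans ux≈0 (sym (zeroʳ _)))

  fromℕ-nonzero : ∀ {x} → 0 < x → ¬ fromℕ x ≈ 0#
  fromℕ-nonzero {suc x} _ = proj₂ (proj₂ isField) x

  pw-two-nonzero : ∀ k → ¬ pw two k ≈ 0#
  pw-two-nonzero k 2ᵏ≈0 = fromℕ-nonzero (ℕₚ.m^n>0 2 k) (trans (sym (pw-two k)) 2ᵏ≈0)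

  two-nonzero : ¬ two ≈ 0#
  two-nonzero 2≈0 = pw-two-nonzero 1 (trans (*-identityʳ two) 2≈0)

  nCk-nonzero : ∀ n k → k ≤ n → ¬ fromℕ (n C k) ≈ 0#
  nCk-nonzero n k k≤n = fromℕ-nonzero (k≤n⇒nCk>0 k≤n)

module CornerCoefficients {c ℓ} (R : CommutativeRing c ℓ) where
  open CommutativeRing R hiding (zero)
  open Poly R
  open FiniteSums R
  open Series R
  open Monomials R
  open Numerals R
  open SetoidReasoning setoid
  open import Algebra.Properties.Ring ring using (-1*x≈-x)

  module X+Y = BinomialExpansion R 1# 0
  module X-Y = BinomialExpansion R (- 1#) 0

  hom-yⁿ : ∀ n A → hom n A 0 0 n ≈ A n
  hom-yⁿ n A = begin
    hom n A 0 0 n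
      ≈⟨ Σs-pointwise n _ 0 0 n ⟩
    Σ≤ n (λ i → A i * ((𝕏 ^^ (n ∸ i)) ⊛ (𝕐 ^^ i)) 0 0 n)
      ≈⟨ Σ≤-single n n ℕₚ.≤-refl (λ i i≤n i≢n →
           trans (*-congˡ (𝕏^^⊛-below (n ∸ i) (𝕐 ^^ i) 0 0 n (ℕₚ.m<n⇒0<n∸m (ℕₚ.≤∧≢⇒< i≤n i≢n)))) (zeroʳ _)) ⟩
    A n * ((𝕏 ^^ (n ∸ n)) ⊛ (𝕐 ^^ n)) 0 0 n
      ≡⟨ ≡.cong (λ k → A n * ((𝕏 ^^ k) ⊛ (𝕐 ^^ n)) 0 0 n) (ℕₚ.n∸n≡0 n) ⟩
    A n * (𝟙 ⊛ (𝕐 ^^ n)) 0 0 n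
      ≈⟨ *-congˡ (trans (⊛-identityˡ (𝕐 ^^ n) 0 0 n) 𝕐^^n-yⁿ) ⟩
    A n * 1#
      ≈⟨ *-identityʳ _ ⟩
    A n ∎
    where
    𝕐^^n-yⁿ : (𝕐 ^^ n) 0 0 n ≈ 1#
    𝕐^^n-yⁿ = begin
      (𝕐 ^^ n) 0 0 n                 ≈⟨ ⊛-identityʳ (𝕐 ^^ n) 0 0 n ⟨
      ((𝕐 ^^ n) ⊛ 𝟙) 0 0 n           ≡⟨ ≡.cong (((𝕐 ^^ n) ⊛ 𝟙) 0 0) (ℕₚ.+-identityʳ n) ⟨
      ((𝕐 ^^ n) ⊛ 𝟙) 0 0 (n ℕ.+ 0)   ≈⟨ 𝕐^^⊛-shift n 𝟙 0 0 0 ⟩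
      1#                             ∎

  substTerm-yⁿ : ∀ r n i → i ≤ n →
    (((r · (𝕏 ⊕ 𝕐)) ^^ (n ∸ i)) ⊛ ((r · (𝕏 ⊕ (⊝ 𝕐))) ^^ i)) 0 0 n ≈ pw r n * pw (- 1#) i
  substTerm-yⁿ r n i i≤n = begin
    Σ≤ n (λ b → F 0 0 b * G 0 0 (n ∸ b))
      ≈⟨ Σ≤-single n (n ∸ i) (ℕₚ.m∸n≤m n i) (λ b _ b≢n∸i →
           trans (*-congʳ (trans (F-coeff b) (*-congˡ (X+Y.L^^-off (n ∸ i) 0 0 b (b≢n∸i ∘ proj₁)))))
                 (trans (*-congʳ (zeroʳ _)) (zeroˡ _))) ⟩
    F 0 0 (n ∸ i) * G 0 0 (n ∸ (n ∸ i))
      ≈⟨ *-cong (trans (F-coeff (n ∸ i)) (*-congˡ (X+Y.L^^-coeff (n ∸ i) 0 (n ∸ i) ≡.refl)))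
                (trans (reflexive (≡.cong (G 0 0) (ℕₚ.m∸[m∸n]≡n i≤n))) (trans (G-coeff i) (*-congˡ (X-Y.L^^-coeff i 0 i ≡.refl)))) ⟩
    (pw r (n ∸ i) * (fromℕ 1 * pw 1# (n ∸ i))) * (pw r i * (fromℕ 1 * pw (- 1#) i))
      ≈⟨ *-cong (trans (*-congˡ (trans (*-cong (+-identityʳ 1#) (pw-1# (n ∸ i))) (*-identityˡ 1#))) (*-identityʳ _))
                (*-congˡ (trans (*-congʳ (+-identityʳ 1#)) (*-identityˡ _))) ⟩
    pw r (n ∸ i) * (pw r i * pw (- 1#) i)
      ≈⟨ *-assoc _ _ _ ⟨
    (pw r (n ∸ i) * pw r i) * pw (- 1#) i
      ≈⟨ *-congʳ (trans (sym (pw-+ r (n ∸ i) i)) (reflexive (≡.cong (pw r) (ℕₚ.m∸n+n≡m i≤n)))) ⟩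
    pw r n * pw (- 1#) i ∎
    where
    F G : Ser
    F = (r · (𝕏 ⊕ 𝕐)) ^^ (n ∸ i)
    G = (r · (𝕏 ⊕ (⊝ 𝕐))) ^^ i
    F-coeff : ∀ b → F 0 0 b ≈ pw r (n ∸ i) * (X+Y.L ^^ (n ∸ i)) 0 0 b
    F-coeff b = trans (·-^^ r (𝕏 ⊕ 𝕐) (n ∸ i) 0 0 b)
                      (*-congˡ (^^-cong (n ∸ i) (λ _ _ _ → trans (+-comm _ _) (+-congʳ (sym (*-identityˡ _)))) 0 0 b))
    G-coeff : ∀ b → G 0 0 b ≈ pw r i * (X-Y.L ^^ i) 0 0 b
    G-coeff b = trans (·-^^ r (𝕏 ⊕ (⊝ 𝕐)) i 0 0 b)
                      (*-congˡ (^^-cong i (λ _ _ _ → trans (+-comm _ _) (+-congʳ (sym (-1*x≈-x _)))) 0 0 b))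

module _ {c ℓ} (R : CommutativeRing c ℓ) where
  open CommutativeRing R hiding (zero)
  open Poly R
  open SecondDifference R using (Δ²)

  module FunctionalEquation
    (isField : IsFieldChar0) (g N : ℕ) (u p : ℕ → Carrier)
    (p≈Δ²u : ∀ m → p m ≈ Δ² (u (suc (suc m))) (u (suc m)) (u m))
    (reflection : ∀ i → i ≤ N → pw two i * u (suc (suc (2 ℕ.* g)) ∸ i) ≈ - (pw two (suc g) * u i))
    where

    open SecondDifference R hiding (Δ²)
    open CharZeroField R isField
    open SetoidReasoning setoid
    open import Algebra.Properties.Ring ring using (-‿distribʳ-*; -‿involutive; -‿injective; -0#≈0#)

    G : ℕ
    G = suc (suc (2 ℕ.* g))

    reflection′ : ∀ i → i ≤ N → pw two (suc g) * u i ≈ - (pw two i * u (G ∸ i))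
    reflection′ i i≤N = trans (sym (-‿involutive _)) (-‿cong (sym (reflection i i≤N)))

    p-reflection : ∀ k → suc (suc k) ≤ N →
      pw two (suc g) * p k ≈ - (pw two (suc k) * Δ² (u (G ∸ k)) (u (G ∸ suc k)) (u (G ∸ suc (suc k))))
    p-reflection k k+2≤N = begin
      Q * p k                                           ≈⟨ *-congˡ (p≈Δ²u k) ⟩
      Q * Δ² (u (suc (suc k))) (u (suc k)) (u k)        ≈⟨ *-distribˡ-Δ² Q _ _ _ ⟩
      Δ² (Q * u (suc (suc k))) (Q * u (suc k)) (Q * u k)
        ≈⟨ Δ²-cong (reflection′ (suc (suc k)) k+2≤N) (reflection′ (suc k) k+1≤N) (reflection′ k k≤N) ⟩
      Δ² (- ((two * t₁) * b₂)) (- (t₁ * b₁)) (- (t * b₀)) ≈⟨ Δ²-neg _ _ _ ⟩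
      - Δ² ((two * t₁) * b₂) (t₁ * b₁) (t * b₀)          ≈⟨ -‿cong (Δ²-cong (*-assoc two t₁ b₂) refl refl) ⟩
      - Δ² (two * (t₁ * b₂)) (t₁ * b₁) (t * b₀)          ≈⟨ -‿cong (Δ²-swap (t₁ * b₂) (t₁ * b₁) (t * b₀)) ⟩
      - Δ² (two * (t * b₀)) (t₁ * b₁) (t₁ * b₂)          ≈⟨ -‿cong (Δ²-cong (*-assoc two t b₀) refl refl) ⟨
      - Δ² (t₁ * b₀) (t₁ * b₁) (t₁ * b₂)                 ≈⟨ -‿cong (*-distribˡ-Δ² t₁ b₀ b₁ b₂) ⟨
      - (t₁ * Δ² b₀ b₁ b₂)                               ∎
      where
      Q = pw two (suc g)
      t = pw two k
      t₁ = pw two (suc k)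
      b₀ = u (G ∸ k)
      b₁ = u (G ∸ suc k)
      b₂ = u (G ∸ suc (suc k))
      k+1≤N = ℕₚ.≤-trans (ℕₚ.n≤1+n (suc k)) k+2≤N
      k≤N = ℕₚ.≤-trans (ℕₚ.n≤1+n k) k+1≤N

    functionalEquation : G ≤ N → FuncEq p g
    functionalEquation G≤N k k≤2g = *-cancelˡ two-nonzero (begin
      two * (pw two g * p k)                   ≈⟨ *-assoc two _ _ ⟨
      pw two (suc g) * p k                     ≈⟨ p-reflection k (ℕₚ.≤-trans (s≤s (s≤s k≤2g)) G≤N) ⟩
      - (pw two (suc k) * Δ² (u (G ∸ k)) (u (G ∸ suc k)) (u (G ∸ suc (suc k))))
        ≈⟨ -‿cong (*-congˡ (sym (trans (p≈Δ²u k′) reflected))) ⟩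
      - (pw two (suc k) * p k′)                ≈⟨ -‿cong (*-assoc two _ _) ⟩
      - (two * (pw two k * p k′))              ≈⟨ -‿distribʳ-* two _ ⟩
      two * - (pw two k * p k′)                ∎)
      where
      k′ = 2 ℕ.* g ∸ k
      reflected : Δ² (u (suc (suc k′))) (u (suc k′)) (u k′) ≈ Δ² (u (G ∸ k)) (u (G ∸ suc k)) (u (G ∸ suc (suc k)))
      reflected = reflexive (≡.cong₂ (λ a b → Δ² (u a) (u b) (u k′))
                                     (≡.sym (ℕₚ.+-∸-assoc 2 k≤2g)) (≡.sym (ℕₚ.+-∸-assoc 1 k≤2g)))

    vanishing : (∀ x → x ≤ 1 → u x ≈ 1#) → ∀ j → 2 ℕ.* g < j → suc (suc j) ≤ N → p j ≈ 0#
    vanishing u≤1 j 2g<j j+2≤N = u*x≈0⇒x≈0 (pw-two-nonzero (suc g)) (begin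
      pw two (suc g) * p j                            ≈⟨ p-reflection j j+2≤N ⟩
      - (pw two (suc j) * Δ² (u (G ∸ j)) (u (G ∸ suc j)) (u (G ∸ suc (suc j))))
        ≈⟨ -‿cong (*-congˡ (trans (Δ²-cong (u≤1 _ G∸j≤1) (u≤1 _ G∸j+1≤1) (u≤1 _ G∸j+2≤1)) (Δ²-const 1#))) ⟩
      - (pw two (suc j) * 0#)                         ≈⟨ trans (-‿cong (zeroʳ _)) -0#≈0# ⟩
      0#                                              ∎)
      where
      G∸j≤1 : G ∸ j ≤ 1
      G∸j≤1 = ℕₚ.m≤n+o⇒m∸n≤o G j (≡.subst (G ≤_) (ℕₚ.+-comm 1 j) (s≤s 2g<j))
      G∸j+1≤1 : G ∸ suc j ≤ 1
      G∸j+1≤1 = ℕₚ.≤-trans (ℕₚ.∸-monoʳ-≤ G (ℕₚ.n≤1+n j)) G∸j≤1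
      G∸j+2≤1 : G ∸ suc (suc j) ≤ 1
      G∸j+2≤1 = ℕₚ.≤-trans (ℕₚ.∸-monoʳ-≤ G (ℕₚ.n≤1+n (suc j))) G∸j+1≤1

    leading-nonzero : G ≤ N → ¬ p 0 ≈ 0# → ¬ p (2 ℕ.* g) ≈ 0#
    leading-nonzero G≤N p₀≉0 p₂g≈0 = p₀≉0 (u*x≈0⇒x≈0 (pw-two-nonzero (2 ℕ.* g)) (-‿injective (begin
      - (pw two (2 ℕ.* g) * p 0)                      ≡⟨ ≡.cong (λ i → - (pw two (2 ℕ.* g) * p i)) (ℕₚ.n∸n≡0 (2 ℕ.* g)) ⟨
      - (pw two (2 ℕ.* g) * p (2 ℕ.* g ∸ 2 ℕ.* g))    ≈⟨ functionalEquation G≤N (2 ℕ.* g) ℕₚ.≤-refl ⟨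
      pw two g * p (2 ℕ.* g)                          ≈⟨ trans (*-congˡ p₂g≈0) (zeroʳ _) ⟩
      0#                                              ≈⟨ -0#≈0# ⟨
      - 0#                                            ∎)))

  module WeightEnumerator
    (isField : IsFieldChar0) (r : Carrier) (r²2≈1 : (r * r) * two ≈ 1#)
    (n d : ℕ) (A : ℕ → Carrier) (isWE : IsFormalWE r n A)
    (A₀≈1 : A 0 ≈ 1#) (gap : ∀ i → 1 ≤ i → i < d → A i ≈ 0#) (A_d≉0 : ¬ A d ≈ 0#)
    (1≤d : 1 ≤ d) (d≤n : d ≤ n) (p : ℕ → Carrier) (isZeta : IsZetaPoly n d A p)
    where

    open FiniteSums R
    open Series R
    open Numerals R
    open Shear R
    open ShearedCoefficients R
    open CornerCoefficients R
    open ZetaCoefficients R n d p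
    open SecondDifference R hiding (Δ²)
    open CharZeroField R isField
    open SetoidReasoning setoid
    open import Algebra.Properties.Ring ring using (-‿distribʳ-*; -‿involutive; -‿injective; -1*x≈-x)
    open import Algebra.Properties.CommutativeSemigroup *-commutativeSemigroup using (x∙yz≈y∙xz)

    B : ℕ → Carrier
    B = shearCoeff n A

    u : ℕ → Carrier
    u y = ζ y + 1#

    u≤1 : ∀ x → x ≤ 1 → u x ≈ 1#
    u≤1 x x≤1 = trans (+-congʳ (ζ≤1 x x≤1)) (+-identityˡ 1#)

    d+M≡n : d ℕ.+ M ≡ n
    d+M≡n = ℕₚ.m+[n∸m]≡n d≤n

    M+d≡n : M ℕ.+ d ≡ n
    M+d≡n = ≡.trans (ℕₚ.+-comm M d) d+M≡n

    macWilliams : ∀ j k → j ℕ.+ k ≡ n → pw r n * (pw two k * B k) ≈ - B j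
    macWilliams j k jk = begin
      pw r n * (pw two k * B k)    ≈⟨ S-subst√2 r n A j k jk ⟨
      S (subst√2 r n A) 0 j k      ≈⟨ S-cong (proj₂ isWE) 0 j k ⟩
      S (⊝ hom n A) 0 j k          ≈⟨ S-⊝ (hom n A) 0 j k ⟩
      - S (hom n A) 0 j k          ≈⟨ -‿cong (S-hom n A j k jk) ⟩
      - B j                        ∎

    B≈C*u : ∀ j k → j ℕ.+ k ≡ n → B j ≈ fromℕ (n C j) * u (suc (suc M) ∸ j)
    B≈C*u j k jk = begin
      B j                                   ≈⟨ trans (+-assoc _ _ _) (trans (+-congˡ (-‿inverseˡ _)) (+-identityʳ _)) ⟨
      (B j - Cⱼ) + Cⱼ                       ≈⟨ +-congʳ (zeta-sheared A isZeta j k jk) ⟨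
      ζ (suc (suc M) ∸ j) * Cⱼ + Cⱼ         ≈⟨ +-cong (*-comm _ _) (sym (*-identityʳ _)) ⟩
      Cⱼ * ζ (suc (suc M) ∸ j) + Cⱼ * 1#    ≈⟨ distribˡ _ _ _ ⟨
      Cⱼ * u (suc (suc M) ∸ j)              ∎
      where Cⱼ = fromℕ (n C j)

    u-reflection : ∀ j k → j ℕ.+ k ≡ n → pw r n * (pw two k * u (suc (suc M) ∸ k)) ≈ - u (suc (suc M) ∸ j)
    u-reflection j k jk = *-cancelˡ (nCk-nonzero n j (≡.subst (j ≤_) jk (ℕₚ.m≤m+n j k))) (begin
      Cₙ j * (pw r n * (pw two k * u (N ∸ k)))   ≈⟨ trans (x∙yz≈y∙xz _ _ _) (*-congˡ (x∙yz≈y∙xz _ _ _)) ⟩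
      pw r n * (pw two k * (Cₙ j * u (N ∸ k)))   ≡⟨ ≡.cong (λ x → pw r n * (pw two k * (fromℕ x * u (N ∸ k)))) nCj≡nCk ⟩
      pw r n * (pw two k * (Cₙ k * u (N ∸ k)))   ≈⟨ *-congˡ (*-congˡ (B≈C*u k j (≡.trans (ℕₚ.+-comm k j) jk))) ⟨
      pw r n * (pw two k * B k)                  ≈⟨ macWilliams j k jk ⟩
      - B j                                      ≈⟨ -‿cong (B≈C*u j k jk) ⟩
      - (Cₙ j * u (N ∸ j))                       ≈⟨ -‿distribʳ-* _ _ ⟩
      Cₙ j * - u (N ∸ j)                         ∎)
      where
      N = suc (suc M)
      Cₙ : ℕ → Carrier
      Cₙ i = fromℕ (n C i)
      nCj≡nCk : n C j ≡ n C k
      nCj≡nCk = ≡.subst (λ x → x C j ≡ x C k) jk ([a+b]Ca≡[a+b]Cb j k)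

    B₀≈ΣA : B 0 ≈ Σ≤ n A
    B₀≈ΣA = Σ≤-cong′ n λ _ → trans (*-congˡ (+-identityʳ 1#)) (*-identityʳ _)

    Bₙ≈A₀ : B n ≈ A 0
    Bₙ≈A₀ = begin
      Σ≤ n (λ i → A i * fromℕ ((n ∸ i) C n))
        ≈⟨ Σ≤-single n 0 z≤n (λ i i≤n i≢0 → trans (*-congˡ (reflexive (≡.cong fromℕ
             (k>n⇒nCk≡0 (ℕₚ.∸-monoʳ-< {n} {i} {0} (ℕₚ.n≢0⇒n>0 i≢0) i≤n))))) (zeroʳ _)) ⟩
      A 0 * fromℕ (n C n)
        ≈⟨ *-congˡ (trans (reflexive (≡.cong fromℕ (nCn≡1 n))) (+-identityʳ 1#)) ⟩
      A 0 * 1#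
        ≈⟨ *-identityʳ _ ⟩
      A 0 ∎

    -- When A i vanishes for odd i, the yⁿ-coefficient of W(r(x + y), r(x - y)) is rⁿ W(1, 1),
    -- which the MacWilliams identity at (j, k) = (n, 0) turns into -A 0.
    sign-invariant⇒Aₙ≈1 : (∀ i → i ≤ n → A i * pw (- 1#) i ≈ A i) → A n ≈ 1#
    sign-invariant⇒Aₙ≈1 even = -‿injective (begin
      - A n                                                 ≈⟨ -‿cong (hom-yⁿ n A) ⟨
      - hom n A 0 0 n                                       ≈⟨ proj₂ isWE 0 0 n ⟨
      subst√2 r n A 0 0 n                                   ≈⟨ Σs-pointwise n _ 0 0 n ⟩
      Σ≤ n (λ i → A i * (((r · (𝕏 ⊕ 𝕐)) ^^ (n ∸ i)) ⊛ ((r · (𝕏 ⊕ (⊝ 𝕐))) ^^ i)) 0 0 n)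
        ≈⟨ Σ≤-cong n (λ i i≤n → trans (*-congˡ (substTerm-yⁿ r n i i≤n))
                                       (trans (x∙yz≈y∙xz _ _ _) (*-congˡ (even i i≤n)))) ⟩
      Σ≤ n (λ i → pw r n * A i)                             ≈⟨ *-distribˡ-Σ≤ n (pw r n) A ⟨
      pw r n * Σ≤ n A                                       ≈⟨ *-congˡ (trans (*-identityˡ _) B₀≈ΣA) ⟨
      pw r n * (pw two 0 * B 0)                             ≈⟨ macWilliams n 0 (ℕₚ.+-identityʳ n) ⟩
      - B n                                                 ≈⟨ -‿cong (trans Bₙ≈A₀ A₀≈1) ⟩
      - 1#                                                  ∎)

    pw-[-1]-even : ∀ t → pw (- 1#) (2 ℕ.* t) ≈ 1#
    pw-[-1]-even t = begin
      pw (- 1#) (t ℕ.+ (t ℕ.+ 0))        ≈⟨ pw-+ (- 1#) t (t ℕ.+ 0) ⟩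
      pw (- 1#) t * pw (- 1#) (t ℕ.+ 0)  ≡⟨ ≡.cong (λ k → pw (- 1#) t * pw (- 1#) k) (ℕₚ.+-identityʳ t) ⟩
      pw (- 1#) t * pw (- 1#) t          ≈⟨ pw-* (- 1#) (- 1#) t ⟨
      pw (- 1# * - 1#) t                 ≈⟨ pw-cong t (trans (-1*x≈-x (- 1#)) (-‿involutive 1#)) ⟩
      pw 1# t                            ≈⟨ pw-1# t ⟩
      1#                                 ∎

    ¬¬-sign-invariant : ∀ i → i ≤ n → ¬ ¬ (A i * pw (- 1#) i ≈ A i)
    ¬¬-sign-invariant i i≤n with parity i
    ... | inj₁ (t , i≡2t)   = λ ¬even → ¬even (trans (*-congˡ (trans (reflexive (≡.cong (pw (- 1#)) i≡2t)) (pw-[-1]-even t)))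
                                                     (*-identityʳ _))
    ... | inj₂ (t , i≡2t+1) = λ ¬even → 4∤odd t (≡.subst (4 ∣_) i≡2t+1 (proj₁ isWE i i≤n λ Aᵢ≈0 →
                                  ¬even (trans (*-congʳ Aᵢ≈0) (trans (zeroˡ _) (sym Aᵢ≈0)))))

    n-even : Σ ℕ λ h → n ≡ 2 ℕ.* h
    n-even with parity n
    ... | inj₁ even         = even
    ... | inj₂ (h , n≡2h+1) = ⊥-elim (¬¬-∀≤ _ n ¬¬-sign-invariant λ even →
      4∤odd h (≡.subst (4 ∣_) n≡2h+1 (proj₁ isWE n ℕₚ.≤-refl λ Aₙ≈0 →
        proj₁ isField (trans (sym (sign-invariant⇒Aₙ≈1 even)) Aₙ≈0))))

    h : ℕ
    h = proj₁ n-even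

    n≡2h : n ≡ 2 ℕ.* h
    n≡2h = proj₂ n-even

    rⁿ2ʰ≈1 : pw r n * pw two h ≈ 1#
    rⁿ2ʰ≈1 = begin
      pw r n * pw two h                ≡⟨ ≡.cong (λ k → pw r k * pw two h) (≡.trans n≡2h (≡.cong (h ℕ.+_) (ℕₚ.+-identityʳ h))) ⟩
      pw r (h ℕ.+ h) * pw two h        ≈⟨ *-congʳ (trans (pw-+ r h h) (sym (pw-* r r h))) ⟩
      pw (r * r) h * pw two h          ≈⟨ pw-* (r * r) two h ⟨
      pw ((r * r) * two) h             ≈⟨ pw-cong h r²2≈1 ⟩
      pw 1# h                          ≈⟨ pw-1# h ⟩
      1#                               ∎

    u-reflection-even : ∀ j k → j ℕ.+ k ≡ n → pw two k * u (suc (suc M) ∸ k) ≈ - (pw two h * u (suc (suc M) ∸ j))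
    u-reflection-even j k jk = begin
      pw two k * u (N ∸ k)                       ≈⟨ *-identityˡ _ ⟨
      1# * (pw two k * u (N ∸ k))                ≈⟨ *-congʳ rⁿ2ʰ≈1 ⟨
      (pw r n * pw two h) * (pw two k * u (N ∸ k)) ≈⟨ trans (*-congʳ (*-comm _ _)) (*-assoc _ _ _) ⟩
      pw two h * (pw r n * (pw two k * u (N ∸ k))) ≈⟨ *-congˡ (u-reflection j k jk) ⟩
      pw two h * - u (N ∸ j)                     ≈⟨ -‿distribʳ-* _ _ ⟨
      - (pw two h * u (N ∸ j))                   ∎
      where N = suc (suc M)

    -- If d > n/2, take j = d - 1 and k = M + 1: both u-values are u at indices ≤ 1,
    -- i.e. 1, and the reflection would give 2ᵏ + 2ʰ = 0.
    d≤h : d ≤ h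
    d≤h with d ℕₚ.≤? h
    ... | yes d≤h = d≤h
    ... | no  d≰h = ⊥-elim (fromℕ-nonzero 2ᵏ+2ʰ>0 (begin
      fromℕ (2 ℕ.^ k ℕ.+ 2 ℕ.^ h)     ≈⟨ fromℕ-+ (2 ℕ.^ k) (2 ℕ.^ h) ⟩
      fromℕ (2 ℕ.^ k) + fromℕ (2 ℕ.^ h) ≈⟨ +-cong (pw-two k) (pw-two h) ⟨
      pw two k + pw two h             ≈⟨ +-congʳ 2ᵏ≈-2ʰ ⟩
      - pw two h + pw two h           ≈⟨ -‿inverseˡ _ ⟩
      0#                              ∎))
      where
      j = d ∸ 1
      k = suc M
      N = suc (suc M)
      2ᵏ+2ʰ>0 : 0 < 2 ℕ.^ k ℕ.+ 2 ℕ.^ h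
      2ᵏ+2ʰ>0 = ℕₚ.<-≤-trans (ℕₚ.m^n>0 2 k) (ℕₚ.m≤m+n _ _)
      1+j≡d : suc j ≡ d
      1+j≡d = ℕₚ.m+[n∸m]≡n 1≤d
      jk : j ℕ.+ k ≡ n
      jk = ≡.trans (ℕₚ.+-suc j M) (≡.trans (≡.cong (ℕ._+ M) 1+j≡d) d+M≡n)
      d+N≤d+d : d ℕ.+ N ≤ d ℕ.+ d
      d+N≤d+d = ≡.subst₂ _≤_ (≡.sym d+N≡2[1+h]) (≡.cong (d ℕ.+_) (ℕₚ.+-identityʳ d)) (ℕₚ.*-monoʳ-≤ 2 (ℕₚ.≰⇒> d≰h))
        where
        d+N≡2[1+h] : d ℕ.+ N ≡ 2 ℕ.* suc h
        d+N≡2[1+h] = ≡.trans (ℕₚ.+-suc d (suc M)) (≡.trans (≡.cong suc (ℕₚ.+-suc d M))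
                       (≡.trans (≡.cong (suc ∘ suc) (≡.trans d+M≡n n≡2h)) (≡.sym (ℕₚ.*-suc 2 h))))
      N∸j≤1 : N ∸ j ≤ 1
      N∸j≤1 = ℕₚ.m≤n+o⇒m∸n≤o N j (≡.subst (N ≤_) (≡.trans (≡.sym 1+j≡d) (ℕₚ.+-comm 1 j)) (ℕₚ.+-cancelˡ-≤ d N d d+N≤d+d))
      2ᵏ≈-2ʰ : pw two k ≈ - pw two h
      2ᵏ≈-2ʰ = begin
        pw two k                 ≈⟨ trans (*-congˡ (u≤1 _ (ℕₚ.≤-reflexive (ℕₚ.m+n∸n≡m 1 (suc M))))) (*-identityʳ _) ⟨
        pw two k * u (N ∸ k)     ≈⟨ u-reflection-even j k jk ⟩
        - (pw two h * u (N ∸ j)) ≈⟨ -‿cong (trans (*-congˡ (u≤1 _ N∸j≤1)) (*-identityʳ _)) ⟩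
        - pw two h               ∎

    2≤d : 2 ≤ d
    2≤d with d ℕₚ.≟ 1
    ... | yes d≡1 = ⊥-elim (4∤odd 0 (≡.subst (4 ∣_) d≡1 (proj₁ isWE d d≤n A_d≉0)))
    ... | no  d≢1 = ℕₚ.≤∧≢⇒< 1≤d (d≢1 ∘ ≡.sym)

    B-at-M : B M ≈ A 0 * fromℕ (n C M) + A d
    B-at-M = begin
      Σ≤ n f                          ≡⟨ ≡.cong (λ N → Σ≤ N f) n≡1+n′ ⟩
      Σ≤ (suc n′) f                   ≈⟨ Σ≤-suc-head n′ f ⟩
      f 0 + Σ≤ n′ (λ i → f (suc i))   ≈⟨ +-congˡ (Σ≤-single n′ j (ℕₚ.∸-monoˡ-≤ 1 d≤n) off) ⟩
      f 0 + f (suc j)                 ≈⟨ +-congˡ (trans (reflexive (≡.cong f 1+j≡d)) f-d) ⟩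
      A 0 * fromℕ (n C M) + A d       ∎
      where
      f : ℕ → Carrier
      f i = A i * fromℕ ((n ∸ i) C M)
      j = d ∸ 1
      n′ = n ∸ 1
      1+j≡d : suc j ≡ d
      1+j≡d = ℕₚ.m+[n∸m]≡n 1≤d
      n≡1+n′ : n ≡ suc n′
      n≡1+n′ = ≡.sym (ℕₚ.m+[n∸m]≡n (ℕₚ.≤-trans 1≤d d≤n))
      f-d : f d ≈ A d
      f-d = trans (*-congˡ (trans (reflexive (≡.cong fromℕ (nCn≡1 M))) (+-identityʳ 1#)))
                  (*-identityʳ _)
      off : ∀ i → i ≤ n′ → i ≢ j → f (suc i) ≈ 0#
      off i i≤n′ i≢j with ℕₚ.<-cmp i j
      ... | tri< i<j _ _ = trans (*-congʳ (gap (suc i) (s≤s z≤n) (≡.subst (suc i <_) 1+j≡d (s≤s i<j)))) (zeroˡ _)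
      ... | tri≈ _ i≡j _ = ⊥-elim (i≢j i≡j)
      ... | tri> _ _ j<i = trans (*-congˡ (reflexive (≡.cong fromℕ (k>n⇒nCk≡0 n∸[1+i]<M)))) (zeroʳ _)
        where
        n∸[1+i]<M : n ∸ suc i < M
        n∸[1+i]<M = ≡.subst (λ x → x ∸ suc i < M) M+d≡n
                      (k<i⇒[j+k]∸i<j M d (suc i) (≡.subst (_< suc i) 1+j≡d (s≤s j<i))
                        (≡.subst (suc i ≤_) (≡.trans (≡.sym n≡1+n′) (≡.sym M+d≡n)) (s≤s i≤n′)))

    ζ₂≉0 : ¬ ζ 2 ≈ 0#
    ζ₂≉0 ζ₂≈0 = A_d≉0 (begin
      A d                             ≈⟨ trans (sym (+-assoc _ _ _)) (trans (+-congʳ (-‿inverseˡ _)) (+-identityˡ _)) ⟨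
      - Cₘ + (Cₘ + A d)               ≈⟨ +-congˡ (+-congʳ (trans (*-congʳ A₀≈1) (*-identityˡ _))) ⟨
      - Cₘ + (A 0 * Cₘ + A d)         ≈⟨ +-congˡ B-at-M ⟨
      - Cₘ + B M                      ≈⟨ +-congˡ (B≈C*u M d M+d≡n) ⟩
      - Cₘ + Cₘ * u (suc (suc M) ∸ M) ≈⟨ +-congˡ (*-congˡ (trans (reflexive (≡.cong u (ℕₚ.m+n∸n≡m 2 M)))
                                                                 (trans (+-congʳ ζ₂≈0) (+-identityˡ 1#)))) ⟩
      - Cₘ + Cₘ * 1#                  ≈⟨ trans (+-congˡ (*-identityʳ _)) (-‿inverseˡ _) ⟩
      0#                              ∎)
      where Cₘ = fromℕ (n C M)

    g : ℕ
    g = suc (h ∸ d)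

    D : ℕ
    D = d ∸ 2

    G : ℕ
    G = suc (suc (2 ℕ.* g))

    d+[h∸d]≡h : d ℕ.+ (h ∸ d) ≡ h
    d+[h∸d]≡h = ℕₚ.m+[n∸m]≡n d≤h

    2+D≡d : 2 ℕ.+ D ≡ d
    2+D≡d = ℕₚ.m+[n∸m]≡n 2≤d

    genus : 2 ℕ.* g ℕ.+ 2 ℕ.* d ≡ n ℕ.+ 2
    genus = ≡.trans (identity d (h ∸ d)) (≡.cong (ℕ._+ 2) (≡.trans (≡.cong (2 ℕ.*_) d+[h∸d]≡h) (≡.sym n≡2h)))
      where
      identity : ∀ d e → 2 ℕ.* suc e ℕ.+ 2 ℕ.* d ≡ 2 ℕ.* (d ℕ.+ e) ℕ.+ 2
      identity = solve-∀

    M≡D+2g : M ≡ D ℕ.+ 2 ℕ.* g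
    M≡D+2g = ≡.trans (ℕₚ.+-cancelˡ-≡ d M (d ℕ.+ 2 ℕ.* (h ∸ d))
                       (≡.trans d+M≡n (≡.trans n≡2h (≡.trans (≡.cong (2 ℕ.*_) (≡.sym d+[h∸d]≡h)) (identity₁ d (h ∸ d))))))
                     (≡.trans (≡.cong (ℕ._+ 2 ℕ.* (h ∸ d)) (≡.sym 2+D≡d)) (identity₂ D (h ∸ d)))
      where
      identity₁ : ∀ d e → 2 ℕ.* (d ℕ.+ e) ≡ d ℕ.+ (d ℕ.+ 2 ℕ.* e)
      identity₁ = solve-∀
      identity₂ : ∀ D e → (2 ℕ.+ D) ℕ.+ 2 ℕ.* e ≡ D ℕ.+ 2 ℕ.* suc e
      identity₂ = solve-∀

    M+2≡D+G : suc (suc M) ≡ D ℕ.+ G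
    M+2≡D+G = ≡.trans (≡.cong (suc ∘ suc) M≡D+2g) (≡.sym (≡.trans (ℕₚ.+-suc D _) (≡.cong suc (ℕₚ.+-suc D _))))

    n≡D+[M+2] : n ≡ D ℕ.+ suc (suc M)
    n≡D+[M+2] = ≡.trans (≡.sym d+M≡n) (≡.trans (≡.cong (ℕ._+ M) (≡.sym 2+D≡d))
                  (≡.sym (≡.trans (ℕₚ.+-suc D _) (≡.cong suc (ℕₚ.+-suc D _)))))

    h≡D+[1+g] : h ≡ D ℕ.+ suc g
    h≡D+[1+g] = ≡.trans (≡.sym d+[h∸d]≡h) (≡.trans (≡.cong (ℕ._+ (h ∸ d)) (≡.sym 2+D≡d))
                  (≡.sym (≡.trans (ℕₚ.+-suc D _) (≡.cong suc (ℕₚ.+-suc D _)))))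

    G≤M+2 : G ≤ suc (suc M)
    G≤M+2 = ≡.subst (G ≤_) (≡.sym M+2≡D+G) (ℕₚ.m≤n+m G D)

    -- The reflection of u with j + k = n, re-indexed by k = D + i and divided by 2ᴰ.
    u-reflection-centred : ∀ i → i ≤ suc (suc M) → pw two i * u (G ∸ i) ≈ - (pw two (suc g) * u i)
    u-reflection-centred i i≤N = *-cancelˡ (pw-two-nonzero D) (begin
      pw two D * (pw two i * u (G ∸ i))      ≈⟨ *-assoc _ _ _ ⟨
      (pw two D * pw two i) * u (G ∸ i)      ≈⟨ *-cong (pw-+ two D i) (reflexive (≡.cong u N∸k≡G∸i)) ⟨
      pw two k * u (N ∸ k)                   ≈⟨ u-reflection-even j k jk ⟩
      - (pw two h * u (N ∸ j))               ≈⟨ -‿cong (*-cong (trans (reflexive (≡.cong (pw two) h≡D+[1+g])) (pw-+ two D (suc g)))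
                                                                (reflexive (≡.cong u (ℕₚ.m∸[m∸n]≡n i≤N)))) ⟩
      - ((pw two D * pw two (suc g)) * u i)  ≈⟨ -‿cong (*-assoc _ _ _) ⟩
      - (pw two D * (pw two (suc g) * u i))  ≈⟨ -‿distribʳ-* _ _ ⟩
      pw two D * - (pw two (suc g) * u i)    ∎)
      where
      N = suc (suc M)
      j = N ∸ i
      k = D ℕ.+ i
      jk : j ℕ.+ k ≡ n
      jk = ≡.trans (swap j D i) (≡.trans (≡.cong (D ℕ.+_) (ℕₚ.m∸n+n≡m i≤N)) (≡.sym n≡D+[M+2]))
        where
        swap : ∀ x y z → x ℕ.+ (y ℕ.+ z) ≡ y ℕ.+ (x ℕ.+ z)
        swap = solve-∀
      N∸k≡G∸i : N ∸ k ≡ G ∸ i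
      N∸k≡G∸i = ≡.trans (≡.cong (_∸ k) M+2≡D+G) (ℕₚ.[m+n]∸[m+o]≡n∸o D G i)

    p≈Δ²u : ∀ m → p m ≈ Δ² (u (suc (suc m))) (u (suc m)) (u m)
    p≈Δ²u m = trans (p≈Δ²ζ m) (sym (Δ²-shift 1# _ _ _))

    module FE = FunctionalEquation isField g (suc (suc M)) u p p≈Δ²u u-reflection-centred

    p₀≉0 : ¬ p 0 ≈ 0#
    p₀≉0 p₀≈0 = ζ₂≉0 (trans (sym p₀≈ζ₂) p₀≈0)
      where
      open import Algebra.Properties.Ring ring using (-0#≈0#)
      p₀≈ζ₂ : p 0 ≈ ζ 2
      p₀≈ζ₂ = trans (p≈Δ²ζ 0) (trans (+-cong (trans (+-congˡ -0#≈0#) (+-identityʳ _))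
                                             (trans (-‿cong (trans (*-congˡ (-‿inverseʳ 0#)) (zeroʳ two))) -0#≈0#))
                                     (+-identityʳ _))

    p-degree : HasDegree p (2 ℕ.* g)
    p-degree = FE.leading-nonzero G≤M+2 p₀≉0 , vanishes-above
      where
      vanishes-above : ∀ j → 2 ℕ.* g < j → p j ≈ 0#
      vanishes-above j 2g<j with j ℕₚ.≤? M
      ... | yes j≤M = FE.vanishing u≤1 j 2g<j (s≤s (s≤s j≤M))
      ... | no  j≰M = proj₁ isZeta j (ℕₚ.≰⇒> j≰M)

    p-functionalEquation : FuncEq p g
    p-functionalEquation = FE.functionalEquation G≤M+2

theorem3p1 : ∀ {c ℓ : Level} (R : CommutativeRing c ℓ) →
    let open CommutativeRing R
        open Poly R
    in IsFieldChar0 →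
       (r : Carrier) → (r * r) * two ≈ 1# →
       (n d : ℕ) (A : ℕ → Carrier) →
       IsFormalWE r n A →
       A 0 ≈ 1# → (∀ i → 1 ℕ.≤ i → i ℕ.< d → A i ≈ 0#) → ¬ A d ≈ 0# →
       1 ℕ.≤ d → d ℕ.≤ n →
       (p : ℕ → Carrier) → IsZetaPoly n d A p →
       Σ ℕ λ g → (2 ℕ.* g ℕ.+ 2 ℕ.* d ≡ n ℕ.+ 2) × HasDegree p (2 ℕ.* g) × FuncEq p g
theorem3p1 R isField r r²2≈1 n d A isWE A₀≈1 gap A_d≉0 1≤d d≤n p isZeta =
  g , genus , p-degree , p-functionalEquation
  where open WeightEnumerator R isField r r²2≈1 n d A isWE A₀≈1 gap A_d≉0 1≤d d≤n p isZeta
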